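{- Let $G=(V,E)$ be a finite $k$-regular graph, $q\geq k$, and $K\subseteq\mathbb{Z}_q$ with $|K|=k$ and $-K=K$. Let $P\subseteq\mathbb{Z}_q$ satisfy $P\cup(-P)=K$ and $P\cap(-P)\subseteq\{a\in\mathbb{Z}_q:a=-a\}$. Then $$\sum_{(\mathcal{F},\sigma)}\mathrm{sgn}(\mathcal{F},\sigma)=\varepsilon\sum_{\substack{z\in\mathbb{Z}_q^H\\ z_{(u,e)}+z_{(v,e)}=0\ \forall e=\{u,v\}}}\ \prod_{v\in V}\phi_K\big((z_h)_{h\in H(v)}\big)$$ for some $\varepsilon\in\{+1,-1\}$ depending on the chosen linear orders of the half-edges at the vertices, where the left sum is over all oriented ordered bipartite (near) $2$-factorizations $(\mathcal{F},\sigma)$ of $G$ indexed by $P$.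
   Context: $\mathbb{Z}_q$ is linearly ordered by $0<1<\cdots<q-1$. For each vertex $v$ the set $H(v)$ of the $k$ half-edges at $v$ is linearly ordered, and arguments $(z_h)_{h\in H(v)}$ are listed in this order. For an injection $\beta$ between linearly ordered sets, $\mathrm{sgn}(\beta)=(-1)^{\#\{\ell<m:\beta(\ell)>\beta(m)\}}$; $\mathrm{sgn}(\beta)=0$ if $\beta$ is not injective. $\phi_K:\mathbb{Z}_q^k\to\{0,\pm1\}$ is $\phi_K(b_0,\ldots,b_{k-1})=\mathrm{sgn}(\ell\mapsto b_\ell)$ if $b_0,\ldots,b_{k-1}$ are distinct elements of $K$, and $0$ otherwise (i.e. $1_{\mathrm{Even}(K)}-1_{\mathrm{Odd}(K)}$). An ordered (near) $2$-factorization indexed by $P$ is a family $\mathcal{F}=(F_a)_{a\in P}$ of pairwise disjoint edge sets partitioning $E$, with $F_a$ a $2$-factor of $G$ if $a\neq-a$ and a $1$-factor if $a=-a$; it is bipartite if every circuit component of every $2$-factor $F_a$ has even length. An orientation $\sigma$ of $\mathcal{F}$ orients the edges of each $2$-factor $F_a$ ($a\neq -a$) so that $F_a$ is a union of directed circuits (the orientation of $1$-factor edges plays no role). Put $\sigma_{v,e}=+1$ if $e$ is directed into $v$, $-1$ if out of $v$. For $e\in F_a$ and $(v,e)\in H(v)$ let $w_{(v,e)}=\sigma_{v,e}a$ if $a\neq-a$ and $w_{(v,e)}=a$ if $a=-a$; then $\mathrm{sgn}(\mathcal{F},\sigma)=\prod_{v\in V}\mathrm{sgn}\big(H(v)\to\mathbb{Z}_q,\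 h\mapsto w_h\big)$. -}

module Defs where

open import Data.Nat using (ℕ; zero; suc; _∸_)
open import Data.Nat.Divisibility using (_∣_)
open import Data.Bool.ListAction using (any; all)
import Data.Nat as ℕ
open import Data.Nat.DivMod using (_mod_)
open import Data.Integer using (ℤ; _+_; _*_; _^_; 0ℤ; 1ℤ; -1ℤ)
open import Data.Fin using (Fin; toℕ; _<?_; _≟_)
open import Data.Fin.Subset using (Subset; _∈_)
open import Data.Fin.Subset.Properties using (_∈?_)
open import Data.List using (List; []; _∷_; map; foldr; filter; allFin; length; concatMap)
open import Data.List.Membership.Propositional using () renaming (_∈_ to _∈ₗ_)
open import Data.List.Relation.Unary.Unique.Propositional using (Unique)
open import Data.Vec using (Vec; lookup)
open import Data.Bool using (Bool; true; false; if_then_else_)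
open import Data.Product using (Σ; ∃; _×_; _,_; proj₁; proj₂)
open import Data.Sum using (_⊎_)
open import Relation.Nullary using (¬_)
open import Relation.Nullary.Decidable using (⌊_⌋; _×-dec_)
open import Relation.Binary.PropositionalEquality using (_≡_)

-- Z_q = Fin q, with arithmetic modulo q.  (Z_q is empty if q = 0.)

_+q_ : ∀ {q} → Fin q → Fin q → Fin q
_+q_ {suc p} a b = (toℕ a ℕ.+ toℕ b) mod (suc p)

-q_ : ∀ {q} → Fin q → Fin q
-q_ {suc p} a = (suc p ∸ toℕ a) mod (suc p)

_∈-_ : ∀ {q} → Fin q → Subset q → Set
y ∈- P = ∃ λ x → x ∈ P × y ≡ -q x

sumℤ : List ℤ → ℤ
sumℤ = foldr _+_ 0ℤ

prodℤ : List ℤ → ℤ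
prodℤ = foldr _*_ 1ℤ

-- sign of a map β : Fin k → Fin q  (Fin k ordered 0<1<..., Z_q ordered 0<1<...<q-1)

pairsLT : (k : ℕ) → List (Fin k × Fin k)
pairsLT k = concatMap (λ l → map (λ m → l , m) (filter (λ m → l <? m) (allFin k))) (allFin k)

notInjective : ∀ {k q} → (Fin k → Fin q) → Bool
notInjective {k} β = any (λ p → ⌊ β (proj₁ p) ≟ β (proj₂ p) ⌋) (pairsLT k)

inversions : ∀ {k q} → (Fin k → Fin q) → ℕ
inversions {k} β = length (filter (λ p → β (proj₂ p) <? β (proj₁ p)) (pairsLT k))

sgn : ∀ {k q} → (Fin k → Fin q) → ℤ
sgn β = if notInjective β then 0ℤ else (-1ℤ ^ inversions β)

φ : ∀ {k q} → Subset q → (Fin k → Fin q) → ℤ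
φ {k} K b = if all (λ l → ⌊ b l ∈? K ⌋) (allFin k) then sgn b else 0ℤ

-- Finite simple graphs: vertices Fin n, edges Fin m, edge e = {u , v}
-- given as an (arbitrary) ordered pair ends e = (u , v).

record Graph (n m : ℕ) : Set where
  field
    ends     : Fin m → Fin n × Fin n
    loopless : ∀ e → ¬ (proj₁ (ends e) ≡ proj₂ (ends e))
    simple   : ∀ e e′ → (ends e ≡ ends e′ ⊎ ends e ≡ (proj₂ (ends e′) , proj₁ (ends e′))) → e ≡ e′
open Graph public

Incident : ∀ {n m} → Graph n m → Fin n → Fin m → Set
Incident G v e = proj₁ (ends G e) ≡ v ⊎ proj₂ (ends G e) ≡ v

-- k-regularity together with a linear order of the half-edges at each vertex:
-- inc v : Fin k → Fin m lists the edges at v (i.e. the half-edges (v,e)) in order,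
-- bijectively onto the edges incident with v.
HalfEdgeOrder : ∀ {n m} → Graph n m → (k : ℕ) → (Fin n → Fin k → Fin m) → Set
HalfEdgeOrder G k inc =
  (∀ v i j → inc v i ≡ inc v j → i ≡ j) ×
  (∀ v e → (Incident G v e → ∃ λ i → inc v i ≡ e) × ((∃ λ i → inc v i ≡ e) → Incident G v e))

Enumerates : ∀ {A : Set} → (A → Set) → List A → Set
Enumerates P L = Unique L × (∀ x → (x ∈ₗ L → P x) × (P x → x ∈ₗ L))

-- Oriented ordered (near) 2-factorizations indexed by P.
-- The family (F_a)_{a∈P} is encoded by col : E → Z_q, F_a = { e : col e = a };
-- the orientation by dir : E → Bool (false: ends e = (u,v) is directed u → v,
-- true: v → u).  Edges of 1-factors (col e = -col e) carry no orientation: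
-- canonically dir e = false.

module _ {n m q : ℕ} (G : Graph n m) (k : ℕ) (inc : Fin n → Fin k → Fin m) where

  degA : Vec (Fin q) m → Fin n → Fin q → ℕ
  degA col v a = length (filter (λ i → lookup col (inc v i) ≟ a) (allFin k))

  headOf tailOf : Vec Bool m → Fin m → Fin n
  headOf dir e = if lookup dir e then proj₁ (ends G e) else proj₂ (ends G e)
  tailOf dir e = if lookup dir e then proj₂ (ends G e) else proj₁ (ends G e)

  inDegA outDegA : Vec (Fin q) m → Vec Bool m → Fin n → Fin q → ℕ
  inDegA col dir v a =
    length (filter (λ i → (lookup col (inc v i) ≟ a) ×-dec (headOf dir (inc v i) ≟ v)) (allFin k))
  outDegA col dir v a =
    length (filter (λ i → (lookup col (inc v i) ≟ a) ×-dec (tailOf dir (inc v i) ≟ v)) (allFin k))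

  data Reach (col : Vec (Fin q) m) (a : Fin q) (u : Fin n) : Fin n → Set where
    here : Reach col a u u
    step : ∀ {w x} e → Reach col a u w → lookup col e ≡ a →
           (ends G e ≡ (w , x) ⊎ ends G e ≡ (x , w)) → Reach col a u x

  -- every circuit component of F_a has even length
  -- (the component of v has edge set { e ∈ F_a : e's endpoint reachable from v })
  EvenComponents : Vec (Fin q) m → Fin q → Set
  EvenComponents col a =
    ∀ v (Le : List (Fin m)) →
      Enumerates (λ e → lookup col e ≡ a × Reach col a v (proj₁ (ends G e))) Le →
      2 ∣ length Le

  IsOrientedBipartiteFactorization : Subset q → Vec (Fin q) m × Vec Bool m → Set
  IsOrientedBipartiteFactorization P (col , dir) =
    (∀ e → lookup col e ∈ P) ×
    (∀ a → a ∈ P → ∀ v → (a ≡ -q a → degA col v a ≡ 1) × (¬ a ≡ -q a → degA col v a ≡ 2)) ×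
    (∀ a → a ∈ P → ¬ a ≡ -q a → EvenComponents col a) ×
    (∀ a → a ∈ P → ¬ a ≡ -q a → ∀ v → inDegA col dir v a ≡ 1 × outDegA col dir v a ≡ 1) ×
    (∀ e → lookup col e ≡ -q (lookup col e) → lookup dir e ≡ false)

  -- w_{(v,e)}; σ_{v,e} = +1 iff e is directed into v
  wHalf : Vec (Fin q) m → Vec Bool m → Fin n → Fin k → Fin q
  wHalf col dir v i with lookup col (inc v i) ≟ -q (lookup col (inc v i))
  ... | Relation.Nullary.yes _ = lookup col (inc v i)
  ... | Relation.Nullary.no _ =
    if ⌊ headOf dir (inc v i) ≟ v ⌋ then lookup col (inc v i) else -q (lookup col (inc v i))

  sgnF : Vec (Fin q) m × Vec Bool m → ℤ
  sgnF (col , dir) = prodℤ (map (λ v → sgn (wHalf col dir v)) (allFin n))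

  -- z ∈ Z_q^H, z_{(v, inc v i)} = lookup (lookup z v) i
  Admissible : Vec (Vec (Fin q) k) n → Set
  Admissible z = ∀ e i j → inc (proj₁ (ends G e)) i ≡ e → inc (proj₂ (ends G e)) j ≡ e →
    toℕ (lookup (lookup z (proj₁ (ends G e))) i +q lookup (lookup z (proj₂ (ends G e))) j) ≡ 0

  weight : Subset q → Vec (Vec (Fin q) k) n → ℤ
  weight K z = prodℤ (map (λ v → φ K (lookup (lookup z v))) (allFin n))

module Submission where

-- Label the half-edge (v,e) of an edge e ∈ F_a by a if e enters v and by -a if it leaves v (by a if a = -a).
-- This is a bijection between the oriented ordered near 2-factorizations indexed by P, bipartite or not, and the
-- admissible z ∈ ℤ_q^H of nonvanishing weight, under which sgn(F,σ) is the weight ∏_v φ_K(z|H(v)); so ε = 1 here.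
-- If some circuit of some 2-factor F_a has odd length, reversing its orientation swaps the labels a and -a of the
-- two half-edges of F_a at each of its vertices, which negates the sign at an odd number of vertices. Reversing the
-- first such circuit is therefore a sign-reversing involution on the non-bipartite factorizations, which cancel.

open import Data.List using (List; []; _∷_; [_]; _++_; map; filter; length; allFin; tabulate; concatMap)
open import Data.List.Properties
  using (map-∘; map-cong; map-tabulate; length-map; length-++; filter-all; filter-accept; filter-reject; filter-++; concatMap-map; concatMap-cong; map-concatMap)
open import Data.List.Membership.Propositional using () renaming (_∈_ to _∈ₗ_)
open import Data.List.Membership.Propositional.Properties using (∈-map⁺; ∈-map⁻; ∈-filter⁺; ∈-filter⁻; ∈-allFin)
open import Data.List.Membership.Propositional.Properties.WithK using (unique∧set⇒bag)
open import Data.List.Relation.Binary.BagAndSetEquality using (∼bag⇒↭)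
open import Data.List.Relation.Binary.Permutation.Propositional using (_↭_; ↭⇒↭ₛ)
open import Data.List.Relation.Binary.Permutation.Propositional.Properties using (↭-length) renaming (map⁺ to ↭-map⁺)
open import Data.List.Relation.Binary.Permutation.Setoid.Properties using (foldr-commMonoid)
open import Data.List.Relation.Unary.All using (All; []; _∷_)
import Data.List.Relation.Unary.All as All
import Data.List.Relation.Unary.All.Properties as All
open import Data.List.Relation.Unary.All.Properties using (all⁺; all⁻)
open import Data.List.Relation.Unary.Any using (here; there)
open import Data.List.Relation.Unary.AllPairs using ([]; _∷_)
open import Data.List.Relation.Unary.Unique.Propositional using (Unique)
import Data.List.Relation.Unary.Unique.Propositional.Properties as Unique
open import Data.Nat using (ℕ; zero; suc; z≤n; s≤s; _≤_; _∸_; _%_)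
import Data.Nat as ℕ
import Data.Nat.Properties as ℕ
open import Algebra.Properties.Semiring.Sum ℕ.+-*-semiring using (sum-syntax; sum-cong-≗; sum-replicate-zero; ∑-comm; *-distribʳ-sum)
open import Data.Nat.DivMod using (m%n<n; n%n≡0; [m+n]%n≡m%n; [m+kn]%n≡m%n; m<n⇒m%n≡m; m%n%n≡m%n; %-distribˡ-+)
open import Data.Nat.Divisibility using (_∣_; _∣?_; divides; m%n≡0⇒n∣m)
open import Data.Bool using (Bool; true; false; _∨_; _∧_; _xor_; not; if_then_else_; T)
import Data.Bool.Properties as Bool
open import Data.Bool.ListAction using (any; all; or; and)
open import Data.Fin using (Fin; zero; suc; toℕ; _<_; _<?_)
open import Data.Fin.Patterns using (0F; 1F)
import Data.Fin.Properties as Fin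
open import Data.Fin.Properties using (any?; all?; ¬∀⟶∃¬; <-cmp; 0≢1+n; toℕ-fromℕ<; toℕ-injective; toℕ<n)
open import Data.Fin.Permutation.Components using (transpose)
open import Data.Integer using (ℤ; _+_; _*_; -_; _^_; 0ℤ; 1ℤ; -1ℤ)
open import Data.Integer.Properties as ℤ using (+-0-isCommutativeMonoid)
open import Data.Integer.Tactic.RingSolver using (solve-∀)
open import Data.Unit using (⊤; tt)
open import Data.Vec using (Vec; lookup)
open import Data.Empty using (⊥-elim)
open import Data.Product using (_×_; _,_; proj₁; proj₂; ∃; ∃₂)
open import Data.Sum using (_⊎_; inj₁; inj₂; [_,_]′)
import Data.Sum as Sum
open import Function using (id; _∘_; _⇔_; mk⇔; Equivalence; case_of_)
open import Relation.Nullary using (Dec; does; ¬_; yes; no; ¬?)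
open import Relation.Nullary.Decidable using (⌊_⌋; decidable-stable; _×-dec_; _⊎-dec_; toWitness; fromWitness; dec-true; dec-false; isYes≗does)
open import Relation.Unary using (Decidable)
open import Relation.Binary using (tri<; tri≈; tri>)
open import Relation.Binary.PropositionalEquality hiding ([_]; J)
open import Data.Fin.Subset using (Subset; _∈_; _⊂_; ∣_∣)
open import Data.Fin.Subset.Properties using (_∈?_; p⊂q⇒∣p∣<∣q∣; ∣p∣≤n)
import Data.Vec as Vec
open import Data.Vec.Properties using (lookup∘tabulate; []=⇒lookup; lookup⇒[]=)
import Data.Vec.Properties as Vec
open import Defs
  using ( sumℤ; prodℤ; Enumerates; pairsLT; notInjective; inversions; sgn; φ; _+q_; -q_; _∈-_
        ; Graph; ends; loopless; Incident; HalfEdgeOrder; Reach; here; step; EvenComponents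
        ; degA; inDegA; outDegA; headOf; tailOf; wHalf; sgnF; weight; Admissible; IsOrientedBipartiteFactorization )

false≢true : false ≢ true
false≢true ()

⌊⌋-true : {P : Set} (P? : Dec P) → P → ⌊ P? ⌋ ≡ true
⌊⌋-true P? p = trans (isYes≗does P?) (dec-true P? p)

⌊⌋-false : {P : Set} (P? : Dec P) → ¬ P → ⌊ P? ⌋ ≡ false
⌊⌋-false P? ¬p = trans (isYes≗does P?) (dec-false P? ¬p)

+-exchangeˡ : ∀ (a b c : ℤ) → a + (b + c) ≡ b + (a + c)
+-exchangeˡ = solve-∀

*-exchangeˡ : ∀ (a b c : ℤ) → a * (b * c) ≡ b * (a * c)
*-exchangeˡ = solve-∀

*-interchange : ∀ (a b c d : ℤ) → (a * b) * (c * d) ≡ (a * c) * (b * d)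
*-interchange = solve-∀

private
  variable
    A B : Set
    P Q : A → Set
    xs ys : List A

Vec-ext : ∀ {n} {f : Fin n → A} (xs : Vec A n) → (∀ i → f i ≡ lookup xs i) → Vec.tabulate f ≡ xs
Vec-ext xs f≗xs = trans (Vec.tabulate-cong f≗xs) (Vec.tabulate∘lookup xs)

Enumerates⇒↭ : Enumerates P xs → Enumerates P ys → xs ↭ ys
Enumerates⇒↭ (xs! , xs≗P) (ys! , ys≗P) = ∼bag⇒↭ (unique∧set⇒bag xs! ys! (mk⇔
  (λ x∈xs → proj₂ (ys≗P _) (proj₁ (xs≗P _) x∈xs))
  (λ x∈ys → proj₂ (xs≗P _) (proj₁ (ys≗P _) x∈ys))))

Enumerates-length : Enumerates P xs → Enumerates P ys → length xs ≡ length ys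
Enumerates-length enumXs enumYs = ↭-length (Enumerates⇒↭ enumXs enumYs)

sumℤ-↭ : {xs ys : List ℤ} → xs ↭ ys → sumℤ xs ≡ sumℤ ys
sumℤ-↭ p = foldr-commMonoid (setoid ℤ) +-0-isCommutativeMonoid (↭⇒↭ₛ p)

sumℤ-map-Enumerates : (g : A → ℤ) → Enumerates P xs → Enumerates P ys →
                      sumℤ (map g xs) ≡ sumℤ (map g ys)
sumℤ-map-Enumerates g enumXs enumYs = sumℤ-↭ (↭-map⁺ g (Enumerates⇒↭ enumXs enumYs))

Unique-map⁺-on : (f : A → B) → (∀ {x y} → x ∈ₗ xs → y ∈ₗ xs → f x ≡ f y → x ≡ y) →
                 Unique xs → Unique (map f xs)
Unique-map⁺-on {xs = []} f inj [] = []
Unique-map⁺-on {xs = x ∷ xs} f inj (x∉xs ∷ xs!) =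
  All.map⁺ (All.tabulate λ y∈xs fx≡fy → All.lookup x∉xs y∈xs (inj (here refl) (there y∈xs) fx≡fy))
  ∷ Unique-map⁺-on f (λ x∈ y∈ → inj (there x∈) (there y∈)) xs!

Enumerates-map : (f : A → B) (g : B → A) →
                 (∀ x → P x → Q (f x)) → (∀ y → Q y → P (g y)) →
                 (∀ x → P x → g (f x) ≡ x) → (∀ y → Q y → f (g y) ≡ y) →
                 Enumerates P xs → Enumerates Q (map f xs)
Enumerates-map {P = P} {Q = Q} {xs = xs} f g f-pres g-pres gf≡id fg≡id (xs! , xs≗P) =
  Unique-map⁺-on f injective xs! , λ y → to y , from y
  where
  injective : ∀ {x x′} → x ∈ₗ xs → x′ ∈ₗ xs → f x ≡ f x′ → x ≡ x′
  injective {x} {x′} x∈ x′∈ fx≡fx′ = begin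
    x         ≡⟨ gf≡id x (proj₁ (xs≗P x) x∈) ⟨
    g (f x)   ≡⟨ cong g fx≡fx′ ⟩
    g (f x′)  ≡⟨ gf≡id x′ (proj₁ (xs≗P x′) x′∈) ⟩
    x′        ∎
    where open ≡-Reasoning
  to : ∀ y → y ∈ₗ map f xs → Q y
  to y y∈ with x , x∈ , refl ← ∈-map⁻ f y∈ = f-pres x (proj₁ (xs≗P x) x∈)
  from : ∀ y → Q y → y ∈ₗ map f xs
  from y Qy = subst (_∈ₗ map f xs) (fg≡id y Qy) (∈-map⁺ f (proj₂ (xs≗P (g y)) (g-pres y Qy)))

Enumerates-resp : (∀ x → P x → Q x) → (∀ x → Q x → P x) → Enumerates P xs → Enumerates Q xs
Enumerates-resp P⇒Q Q⇒P (xs! , xs≗P) = xs! , λ x → P⇒Q x ∘ proj₁ (xs≗P x) , proj₂ (xs≗P x) ∘ Q⇒P x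

Enumerates-filter⁺ : (Q? : Decidable Q) → Enumerates P xs → Enumerates (λ x → P x × Q x) (filter Q? xs)
Enumerates-filter⁺ {xs = xs} Q? (xs! , xs≗P) = Unique.filter⁺ Q? xs! , λ x →
  (λ x∈ → let x∈xs , Qx = ∈-filter⁻ Q? {xs = xs} x∈ in proj₁ (xs≗P x) x∈xs , Qx) ,
  (λ (Px , Qx) → ∈-filter⁺ Q? (proj₂ (xs≗P x) Px) Qx)

Enumerates-allFin : ∀ n → Enumerates (λ (_ : Fin n) → ⊤) (allFin n)
Enumerates-allFin n = Unique.allFin⁺ n , λ i → (λ _ → tt) , (λ _ → ∈-allFin i)

Enumerates-filter-allFin : ∀ {n} {P : Fin n → Set} (P? : Decidable P) → Enumerates P (filter P? (allFin n))
Enumerates-filter-allFin {n} P? = Enumerates-resp (λ _ → proj₂) (λ _ → tt ,_) (Enumerates-filter⁺ P? (Enumerates-allFin n))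

Enumerates-[] : (∀ x → ¬ P x) → Enumerates P []
Enumerates-[] ¬P = [] , λ x → (λ ()) , (λ Px → ⊥-elim (¬P x Px))

Enumerates-[_] : ∀ x → P x → (∀ y → P y → y ≡ x) → Enumerates P [ x ]
Enumerates-[ x ] Px P⇒≡x = ([] ∷ []) , λ y → (λ { (here refl) → Px }) , (λ Py → here (P⇒≡x y Py))

Enumerates-pair : ∀ x y → x ≢ y → P x → P y → (∀ z → P z → z ≡ x ⊎ z ≡ y) → Enumerates P (x ∷ y ∷ [])
Enumerates-pair x y x≢y Px Py P⇒≡x⊎≡y = ((x≢y ∷ []) ∷ [] ∷ []) , λ z →
  (λ { (here refl) → Px ; (there (here refl)) → Py }) ,
  (λ Pz → [ here , there ∘ here ]′ (P⇒≡x⊎≡y z Pz))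

Enumerates-length≡1⇒unique : Enumerates P xs → length xs ≡ 1 → ∀ {x y} → P x → P y → x ≡ y
Enumerates-length≡1⇒unique {xs = _ ∷ []} (_ , xs≗P) _ {x} {y} Px Py
  with here refl ← proj₂ (xs≗P x) Px | here refl ← proj₂ (xs≗P y) Py = refl

Enumerates-length≡2⇒pair : Enumerates P xs → length xs ≡ 2 →
  ∃₂ λ x y → x ≢ y × P x × P y × (∀ z → P z → z ≡ x ⊎ z ≡ y)
Enumerates-length≡2⇒pair {xs = x ∷ y ∷ []} (((x≢y ∷ []) ∷ _) , xs≗P) _ =
  x , y , x≢y , proj₁ (xs≗P x) (here refl) , proj₁ (xs≗P y) (there (here refl)) ,
  λ z Pz → case proj₂ (xs≗P z) Pz of λ where
    (here z≡x) → inj₁ z≡x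
    (there (here z≡y)) → inj₂ z≡y

sumℤ-map-cong : (g h : A → ℤ) → (∀ x → x ∈ₗ xs → g x ≡ h x) → sumℤ (map g xs) ≡ sumℤ (map h xs)
sumℤ-map-cong {xs = []} g h g≗h = refl
sumℤ-map-cong {xs = x ∷ xs} g h g≗h = cong₂ _+_ (g≗h x (here refl)) (sumℤ-map-cong g h (λ y → g≗h y ∘ there))

sumℤ-map-neg : (g : A → ℤ) (xs : List A) → sumℤ (map (λ x → - g x) xs) ≡ - sumℤ (map g xs)
sumℤ-map-neg g [] = refl
sumℤ-map-neg g (x ∷ xs) = trans (cong (- g x +_) (sumℤ-map-neg g xs)) (sym (ℤ.neg-distrib-+ (g x) _))

i≡-i⇒i≡0 : ∀ (i : ℤ) → i ≡ - i → i ≡ 0ℤ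
i≡-i⇒i≡0 (ℤ.pos zero) _ = refl

sumℤ-involution≡0 : (ρ : A → A) (g : A → ℤ) → Enumerates P xs →
  (∀ x → P x → P (ρ x)) → (∀ x → P x → ρ (ρ x) ≡ x) → (∀ x → P x → g (ρ x) ≡ - g x) →
  sumℤ (map g xs) ≡ 0ℤ
sumℤ-involution≡0 {P = P} {xs = xs} ρ g enumXs ρ-pres ρ-involutive g∘ρ≡-g = i≡-i⇒i≡0 _ (begin
  sumℤ (map g xs)                ≡⟨ sumℤ-map-Enumerates g enumXs enumρXs ⟩
  sumℤ (map g (map ρ xs))        ≡⟨ cong sumℤ (map-∘ xs) ⟨
  sumℤ (map (g ∘ ρ) xs)          ≡⟨ sumℤ-map-cong (g ∘ ρ) (λ x → - g x) (λ x x∈ → g∘ρ≡-g x (proj₁ (proj₂ enumXs x) x∈)) ⟩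
  sumℤ (map (λ x → - g x) xs)    ≡⟨ sumℤ-map-neg g xs ⟩
  - sumℤ (map g xs)              ∎)
  where
  open ≡-Reasoning
  enumρXs : Enumerates P (map ρ xs)
  enumρXs = Enumerates-map ρ ρ ρ-pres ρ-pres ρ-involutive ρ-involutive enumXs

sumℤ-map-filter : (Q? : Decidable Q) (g : A → ℤ) (xs : List A) →
  sumℤ (map g xs) ≡ sumℤ (map g (filter Q? xs)) + sumℤ (map g (filter (¬? ∘ Q?) xs))
sumℤ-map-filter Q? g [] = refl
sumℤ-map-filter Q? g (x ∷ xs) with Q? x
... | yes _ = trans (cong (g x +_) (sumℤ-map-filter Q? g xs)) (sym (ℤ.+-assoc (g x) _ _))
... | no _ = trans (cong (g x +_) (sumℤ-map-filter Q? g xs))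
                 (+-exchangeˡ (g x) (sumℤ (map g (filter Q? xs))) (sumℤ (map g (filter (¬? ∘ Q?) xs))))

sumℤ-map-filter-vanishing : (Q? : Decidable Q) (g : A → ℤ) (xs : List A) → (∀ x → ¬ Q x → g x ≡ 0ℤ) →
  sumℤ (map g xs) ≡ sumℤ (map g (filter Q? xs))
sumℤ-map-filter-vanishing Q? g [] _ = refl
sumℤ-map-filter-vanishing Q? g (x ∷ xs) g≡0 with Q? x
... | yes _ = cong (g x +_) (sumℤ-map-filter-vanishing Q? g xs g≡0)
... | no ¬Qx = trans (cong₂ _+_ (g≡0 x ¬Qx) (sumℤ-map-filter-vanishing Q? g xs g≡0)) (ℤ.+-identityˡ _)

prodℤ-map-zero : (f : A → ℤ) {x : A} (xs : List A) → x ∈ₗ xs → f x ≡ 0ℤ → prodℤ (map f xs) ≡ 0ℤ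
prodℤ-map-zero f (y ∷ xs) (here refl) fx≡0 = cong (_* prodℤ (map f xs)) fx≡0
prodℤ-map-zero f (y ∷ xs) (there x∈) fx≡0 = trans (cong (f y *_) (prodℤ-map-zero f xs x∈ fx≡0)) (ℤ.*-zeroʳ (f y))

prodℤ-map-negate-on : (Q? : Decidable Q) (f f′ : A → ℤ) (xs : List A) →
  (∀ x → Q x → f′ x ≡ - f x) → (∀ x → ¬ Q x → f′ x ≡ f x) →
  prodℤ (map f′ xs) ≡ -1ℤ ^ length (filter Q? xs) * prodℤ (map f xs)
prodℤ-map-negate-on Q? f f′ [] _ _ = refl
prodℤ-map-negate-on Q? f f′ (x ∷ xs) negated kept with Q? x
... | yes Qx = begin
  f′ x * prodℤ (map f′ xs)           ≡⟨ cong₂ _*_ (trans (negated x Qx) (sym (ℤ.-1*i≡-i (f x)))) (prodℤ-map-negate-on Q? f f′ xs negated kept) ⟩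
  (-1ℤ * f x) * (-1ℤ ^ c * prodℤ (map f xs)) ≡⟨ *-interchange -1ℤ (f x) (-1ℤ ^ c) (prodℤ (map f xs)) ⟩
  (-1ℤ * -1ℤ ^ c) * (f x * prodℤ (map f xs)) ∎
  where
  open ≡-Reasoning
  c : ℕ
  c = length (filter Q? xs)
... | no ¬Qx = trans (cong₂ _*_ (kept x ¬Qx) (prodℤ-map-negate-on Q? f f′ xs negated kept))
                       (*-exchangeˡ (f x) (-1ℤ ^ length (filter Q? xs)) (prodℤ (map f xs)))

-1ℤ^odd : ∀ n → ¬ 2 ∣ n → -1ℤ ^ n ≡ -1ℤ
-1ℤ^odd zero 2∤0 = ⊥-elim (2∤0 (divides 0 refl))
-1ℤ^odd (suc zero) _ = refl
-1ℤ^odd (suc (suc n)) 2∤2+n = begin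
  -1ℤ * (-1ℤ * -1ℤ ^ n)   ≡⟨ ℤ.*-assoc -1ℤ -1ℤ (-1ℤ ^ n) ⟨
  1ℤ * -1ℤ ^ n            ≡⟨ ℤ.*-identityˡ (-1ℤ ^ n) ⟩
  -1ℤ ^ n                 ≡⟨ -1ℤ^odd n (λ { (divides c n≡c*2) → 2∤2+n (divides (suc c) (cong (λ m → suc (suc m)) n≡c*2)) }) ⟩
  -1ℤ                     ∎
  where open ≡-Reasoning

∏ : ∀ {k} → (Fin k → ℤ) → ℤ
∏ {zero} f = 1ℤ
∏ {suc k} f = f zero * ∏ (f ∘ suc)

∏-cong : ∀ {k} {f g : Fin k → ℤ} → (∀ i → f i ≡ g i) → ∏ f ≡ ∏ g
∏-cong {zero} f≗g = refl
∏-cong {suc k} f≗g = cong₂ _*_ (f≗g zero) (∏-cong (f≗g ∘ suc))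

∏-zero : ∀ {k} (f : Fin k → ℤ) i → f i ≡ 0ℤ → ∏ f ≡ 0ℤ
∏-zero f zero fi≡0 = cong (_* ∏ (f ∘ suc)) fi≡0
∏-zero f (suc i) fi≡0 = trans (cong (f zero *_) (∏-zero (f ∘ suc) i fi≡0)) (ℤ.*-zeroʳ (f zero))

∏-≢0 : ∀ {k} (f : Fin k → ℤ) → (∀ i → f i ≢ 0ℤ) → ∏ f ≢ 0ℤ
∏-≢0 {zero} f _ ()
∏-≢0 {suc k} f f≢0 ∏≡0 with ℤ.i*j≡0⇒i≡0∨j≡0 (f zero) ∏≡0
... | inj₁ f0≡0 = f≢0 zero f0≡0
... | inj₂ ∏≡0′ = ∏-≢0 (f ∘ suc) (f≢0 ∘ suc) ∏≡0′

∏-list : ∀ {k} (f : Fin k → ℤ) → ∏ f ≡ prodℤ (map f (allFin k))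
∏-list {zero} f = refl
∏-list {suc k} f = cong (f zero *_) (begin
  ∏ (f ∘ suc)                           ≡⟨ ∏-list (f ∘ suc) ⟩
  prodℤ (map (f ∘ suc) (allFin k))      ≡⟨ cong prodℤ (map-∘ (allFin k)) ⟩
  prodℤ (map f (map suc (allFin k)))    ≡⟨ cong (prodℤ ∘ map f) (map-tabulate id suc) ⟩
  prodℤ (map f (tabulate suc))          ∎)
  where open ≡-Reasoning

ordSign : ∀ {q} → Fin q → Fin q → ℤ
ordSign x y with <-cmp x y
... | tri< _ _ _ = 1ℤ
... | tri≈ _ _ _ = 0ℤ
... | tri> _ _ _ = -1ℤ

ordSign-antisym : ∀ {q} (x y : Fin q) → ordSign y x ≡ - ordSign x y
ordSign-antisym x y with <-cmp x y | <-cmp y x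
... | tri< _ _ _    | tri> _ _ _    = refl
... | tri≈ _ _ _    | tri≈ _ _ _    = refl
... | tri> _ _ _    | tri< _ _ _    = refl
... | tri< x<y _ _  | tri< y<x _ _  = ⊥-elim (Fin.<-asym x<y y<x)
... | tri< x<y _ _  | tri≈ _ y≡x _  = ⊥-elim (Fin.<-irrefl (sym y≡x) x<y)
... | tri≈ _ x≡y _  | tri< _ y≢x _  = ⊥-elim (y≢x (sym x≡y))
... | tri≈ _ x≡y _  | tri> _ y≢x _  = ⊥-elim (y≢x (sym x≡y))
... | tri> _ _ y<x  | tri≈ _ y≡x _  = ⊥-elim (Fin.<-irrefl y≡x y<x)
... | tri> _ _ y<x  | tri> _ _ x<y  = ⊥-elim (Fin.<-asym y<x x<y)

ordSign-refl : ∀ {q} (x : Fin q) → ordSign x x ≡ 0ℤ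
ordSign-refl x with <-cmp x x
... | tri< x<x _ _ = ⊥-elim (Fin.<-irrefl refl x<x)
... | tri≈ _ _ _ = refl
... | tri> _ _ x<x = ⊥-elim (Fin.<-irrefl refl x<x)

ordSign-≢0 : ∀ {q} {x y : Fin q} → x ≢ y → ordSign x y ≢ 0ℤ
ordSign-≢0 {x = x} {y} x≢y with <-cmp x y
... | tri< _ _ _ = λ ()
... | tri≈ _ x≡y _ = ⊥-elim (x≢y x≡y)
... | tri> _ _ _ = λ ()

sgnProd : ∀ {k q} → (Fin k → Fin q) → ℤ
sgnProd {zero} β = 1ℤ
sgnProd {suc k} β = ∏ (λ m → ordSign (β zero) (β (suc m))) * sgnProd (β ∘ suc)

sgnProd-cong : ∀ {k q} {β γ : Fin k → Fin q} → (∀ i → β i ≡ γ i) → sgnProd β ≡ sgnProd γ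
sgnProd-cong {zero} β≗γ = refl
sgnProd-cong {suc k} β≗γ =
  cong₂ _*_ (∏-cong (λ m → cong₂ ordSign (β≗γ zero) (β≗γ (suc m)))) (sgnProd-cong (β≗γ ∘ suc))

sgnProd-noninjective : ∀ {k q} (β : Fin k → Fin q) {i j} → i ≢ j → β i ≡ β j → sgnProd β ≡ 0ℤ
sgnProd-noninjective β {zero} {zero} i≢j _ = ⊥-elim (i≢j refl)
sgnProd-noninjective β {zero} {suc j} _ βi≡βj =
  cong (_* sgnProd (β ∘ suc)) (∏-zero _ j (trans (cong (λ x → ordSign x (β (suc j))) βi≡βj) (ordSign-refl _)))
sgnProd-noninjective β {suc i} {zero} _ βi≡βj =
  cong (_* sgnProd (β ∘ suc)) (∏-zero _ i (trans (cong (λ x → ordSign x (β (suc i))) (sym βi≡βj)) (ordSign-refl _)))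
sgnProd-noninjective β {suc i} {suc j} i≢j βi≡βj =
  trans (cong (∏ (λ m → ordSign (β zero) (β (suc m))) *_) (sgnProd-noninjective (β ∘ suc) (i≢j ∘ cong suc) βi≡βj))
        (ℤ.*-zeroʳ (∏ (λ m → ordSign (β zero) (β (suc m)))))

sgnProd-≢0 : ∀ {k q} (β : Fin k → Fin q) → (∀ i j → β i ≡ β j → i ≡ j) → sgnProd β ≢ 0ℤ
sgnProd-≢0 {zero} β _ ()
sgnProd-≢0 {suc k} β β-injective sgnProd≡0 with ℤ.i*j≡0⇒i≡0∨j≡0 (∏ (λ m → ordSign (β zero) (β (suc m)))) sgnProd≡0
... | inj₁ ∏≡0 = ∏-≢0 _ (λ m → ordSign-≢0 (λ β0≡βm → 0≢1+n (β-injective zero (suc m) β0≡βm))) ∏≡0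
... | inj₂ rest≡0 = sgnProd-≢0 (β ∘ suc) (λ i j βi≡βj → Fin.suc-injective (β-injective (suc i) (suc j) βi≡βj)) rest≡0

Transposed : ∀ {k} {A : Set} → (Fin k → A) → (Fin k → A) → Fin k → Fin k → Set
Transposed β β′ i j = i ≢ j × β′ i ≡ β j × β′ j ≡ β i × (∀ l → l ≢ i → l ≢ j → β′ l ≡ β l)

Transposed-sym : ∀ {k} {A : Set} {β β′ : Fin k → A} {i j} → Transposed β β′ i j → Transposed β β′ j i
Transposed-sym (i≢j , β′i , β′j , β′l) = i≢j ∘ sym , β′j , β′i , λ l l≢j l≢i → β′l l l≢i l≢j

Transposed-suc : ∀ {k} {A : Set} {β β′ : Fin (suc k) → A} {i j} → Transposed β β′ (suc i) (suc j) →
                 β′ zero ≡ β zero × Transposed (β ∘ suc) (β′ ∘ suc) i j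
Transposed-suc (i≢j , β′i , β′j , β′l) =
  β′l zero 0≢1+n 0≢1+n , i≢j ∘ cong suc , β′i , β′j ,
  λ l l≢i l≢j → β′l (suc l) (l≢i ∘ Fin.suc-injective) (l≢j ∘ Fin.suc-injective)

Transposed-∘ : ∀ {k} {A B : Set} (f : A → B) {β β′ : Fin k → A} {i j} →
               Transposed β β′ i j → Transposed (f ∘ β) (f ∘ β′) i j
Transposed-∘ f (i≢j , β′i , β′j , β′l) = i≢j , cong f β′i , cong f β′j , λ l l≢i l≢j → cong f (β′l l l≢i l≢j)

module _ {k : ℕ} (i j : Fin k) where

  transpose-matchˡ : transpose i j i ≡ j
  transpose-matchˡ rewrite dec-true (i Fin.≟ i) refl = refl

  transpose-matchʳ : i ≢ j → transpose i j j ≡ i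
  transpose-matchʳ i≢j rewrite dec-false (j Fin.≟ i) (i≢j ∘ sym) | dec-true (j Fin.≟ j) refl = refl

  transpose-other : ∀ {l} → l ≢ i → l ≢ j → transpose i j l ≡ l
  transpose-other {l} l≢i l≢j rewrite dec-false (l Fin.≟ i) l≢i | dec-false (l Fin.≟ j) l≢j = refl

  Transposed-transpose : ∀ {A : Set} (β : Fin k → A) → i ≢ j → Transposed β (β ∘ transpose i j) i j
  Transposed-transpose β i≢j =
    i≢j , cong β transpose-matchˡ , cong β (transpose-matchʳ i≢j) , λ l l≢i l≢j → cong β (transpose-other l≢i l≢j)

*-∏-update : ∀ {k} (h h′ : Fin k → ℤ) j x → h′ j ≡ x → (∀ m → m ≢ j → h′ m ≡ h m) → h j * ∏ h′ ≡ x * ∏ h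
*-∏-update h h′ zero x h′j≡x h′m≡hm =
  trans (cong (h zero *_) (cong₂ _*_ h′j≡x (∏-cong (λ m → h′m≡hm (suc m) (0≢1+n ∘ sym)))))
        (*-exchangeˡ (h zero) x _)
*-∏-update h h′ (suc j) x h′j≡x h′m≡hm = begin
  h (suc j) * (h′ zero * ∏ (h′ ∘ suc))   ≡⟨ *-exchangeˡ (h (suc j)) (h′ zero) _ ⟩
  h′ zero * (h (suc j) * ∏ (h′ ∘ suc))   ≡⟨ cong₂ _*_ (h′m≡hm zero 0≢1+n)
                                             (*-∏-update (h ∘ suc) (h′ ∘ suc) j x h′j≡x (λ m m≢j → h′m≡hm (suc m) (m≢j ∘ Fin.suc-injective))) ⟩
  h zero * (x * ∏ (h ∘ suc))             ≡⟨ *-exchangeˡ (h zero) x _ ⟩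
  x * (h zero * ∏ (h ∘ suc))             ∎
  where open ≡-Reasoning

∏-transposed : ∀ {k} {f f′ : Fin k → ℤ} {i j} → Transposed f f′ i j → ∏ f′ ≡ ∏ f
∏-transposed {i = zero} {zero} (i≢j , _) = ⊥-elim (i≢j refl)
∏-transposed {f = f} {f′} {zero} {suc j} (_ , f′0 , f′j , f′l) =
  trans (cong (_* ∏ (f′ ∘ suc)) f′0)
        (*-∏-update (f ∘ suc) (f′ ∘ suc) j (f zero) f′j (λ m m≢j → f′l (suc m) (0≢1+n ∘ sym) (m≢j ∘ Fin.suc-injective)))
∏-transposed {i = suc i} {zero} τ = ∏-transposed (Transposed-sym τ)
∏-transposed {i = suc i} {suc j} τ with f′0≡f0 , τ′ ← Transposed-suc τ = cong₂ _*_ f′0≡f0 (∏-transposed τ′)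

sgnProd-transposed₀₁ : ∀ {k q} {β β′ : Fin (suc (suc k)) → Fin q} → Transposed β β′ zero (suc zero) →
                       sgnProd β′ ≡ - sgnProd β
sgnProd-transposed₀₁ {k} {β = β} {β′} (_ , β′0 , β′1 , β′l) = begin
  (ordSign (β′ 0F) (β′ 1F) * ∏ (λ m → ordSign (β′ 0F) (β′ (2+ m)))) * (∏ (λ m → ordSign (β′ 1F) (β′ (2+ m))) * sgnProd (β′ ∘ 2+))
    ≡⟨ cong₂ _*_ (cong₂ _*_ (trans (cong₂ ordSign β′0 β′1) (ordSign-antisym (β 0F) (β 1F)))
                            (∏-cong (λ m → cong₂ ordSign β′0 (β′2+ m))))
                 (cong₂ _*_ (∏-cong (λ m → cong₂ ordSign β′1 (β′2+ m))) (sgnProd-cong β′2+)) ⟩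
  (- a * c) * (b * r)
    ≡⟨ cong (_* (b * r)) (ℤ.neg-distribˡ-* a c) ⟨
  - (a * c) * (b * r)
    ≡⟨ ℤ.neg-distribˡ-* (a * c) (b * r) ⟨
  - ((a * c) * (b * r))
    ≡⟨ cong -_ (*-interchange a c b r) ⟩
  - ((a * b) * (c * r)) ∎
  where
  open ≡-Reasoning
  2+ : Fin k → Fin (suc (suc k))
  2+ m = suc (suc m)
  β′2+ : ∀ m → β′ (2+ m) ≡ β (2+ m)
  β′2+ m = β′l (2+ m) (0≢1+n ∘ sym) (0≢1+n ∘ sym ∘ Fin.suc-injective)
  a b c r : ℤ
  a = ordSign (β 0F) (β 1F)
  b = ∏ (λ m → ordSign (β 0F) (β (2+ m)))
  c = ∏ (λ m → ordSign (β 1F) (β (2+ m)))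
  r = sgnProd (β ∘ 2+)

mutual
  sgnProd-transposed : ∀ {k q} {β β′ : Fin k → Fin q} {i j} → Transposed β β′ i j → sgnProd β′ ≡ - sgnProd β
  sgnProd-transposed {i = zero} {zero} (i≢j , _) = ⊥-elim (i≢j refl)
  sgnProd-transposed {suc k} {i = zero} {suc j} τ = sgnProd-transposed₀ τ
  sgnProd-transposed {suc k} {i = suc i} {zero} τ = sgnProd-transposed₀ (Transposed-sym τ)
  sgnProd-transposed {suc k} {i = suc i} {suc j} τ = sgnProd-transposed-suc τ

  sgnProd-transposed₀ : ∀ {k q} {β β′ : Fin (suc k) → Fin q} {j} → Transposed β β′ zero (suc j) →
                        sgnProd β′ ≡ - sgnProd β
  sgnProd-transposed₀ {suc k} {j = zero} τ = sgnProd-transposed₀₁ τ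
  sgnProd-transposed₀ {suc (suc k)} {β = β} {β′} {suc j} (_ , β′0 , β′J , β′l) = begin
    sgnProd β′   ≡⟨ sgnProd-cong β′≗γ₃ ⟩
    sgnProd γ₃   ≡⟨ sgnProd-transposed-suc (Transposed-transpose 1F J γ₂ 1≢J) ⟩
    - sgnProd γ₂ ≡⟨ cong -_ (sgnProd-transposed₀₁ (Transposed-transpose 0F 1F γ₁ 0≢1+n)) ⟩
    - - sgnProd γ₁ ≡⟨ ℤ.neg-involutive _ ⟩
    sgnProd γ₁   ≡⟨ sgnProd-transposed-suc (Transposed-transpose 1F J β 1≢J) ⟩
    - sgnProd β  ∎
    where
    open ≡-Reasoning
    J : Fin (suc (suc (suc k)))
    J = suc (suc j)
    0≢J : 0F ≢ J
    0≢J ()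
    1≢J : 1F ≢ J
    1≢J ()
    γ₁ γ₂ γ₃ : Fin (suc (suc (suc k))) → _
    γ₁ = β ∘ transpose 1F J
    γ₂ = γ₁ ∘ transpose 0F 1F
    γ₃ = γ₂ ∘ transpose 1F J
    β′≗γ₃ : ∀ l → β′ l ≡ γ₃ l
    β′≗γ₃ l = cases l (l Fin.≟ 0F) (l Fin.≟ 1F) (l Fin.≟ J)
      where
      cases : ∀ l → Dec (l ≡ 0F) → Dec (l ≡ 1F) → Dec (l ≡ J) → β′ l ≡ γ₃ l
      cases _ (yes refl) _ _ = trans β′0 (cong β (sym (begin
            transpose 1F J (transpose 0F 1F (transpose 1F J 0F)) ≡⟨ cong (transpose 1F J ∘ transpose 0F 1F) (transpose-other 1F J 0≢1+n 0≢J) ⟩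
            transpose 1F J (transpose 0F 1F 0F)                  ≡⟨ cong (transpose 1F J) (transpose-matchˡ 0F 1F) ⟩
            transpose 1F J 1F                                    ≡⟨ transpose-matchˡ 1F J ⟩
            J                                                    ∎)))
      cases _ (no _) (yes refl) _ = trans (β′l 1F (0≢1+n ∘ sym) 1≢J) (cong β (sym (begin
            transpose 1F J (transpose 0F 1F (transpose 1F J 1F)) ≡⟨ cong (transpose 1F J ∘ transpose 0F 1F) (transpose-matchˡ 1F J) ⟩
            transpose 1F J (transpose 0F 1F J)                   ≡⟨ cong (transpose 1F J) (transpose-other 0F 1F (0≢J ∘ sym) (1≢J ∘ sym)) ⟩
            transpose 1F J J                                     ≡⟨ transpose-matchʳ 1F J 1≢J ⟩
            1F                                                   ∎)))
      cases _ (no _) (no _) (yes refl) = trans β′J (cong β (sym (begin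
            transpose 1F J (transpose 0F 1F (transpose 1F J J)) ≡⟨ cong (transpose 1F J ∘ transpose 0F 1F) (transpose-matchʳ 1F J 1≢J) ⟩
            transpose 1F J (transpose 0F 1F 1F)                 ≡⟨ cong (transpose 1F J) (transpose-matchʳ 0F 1F 0≢1+n) ⟩
            transpose 1F J 0F                                   ≡⟨ transpose-other 1F J 0≢1+n 0≢J ⟩
            0F                                                  ∎)))
      cases l (no l≢0) (no l≢1) (no l≢J) = trans (β′l l l≢0 l≢J) (cong β (sym (begin
            transpose 1F J (transpose 0F 1F (transpose 1F J l)) ≡⟨ cong (transpose 1F J ∘ transpose 0F 1F) (transpose-other 1F J l≢1 l≢J) ⟩
            transpose 1F J (transpose 0F 1F l)                  ≡⟨ cong (transpose 1F J) (transpose-other 0F 1F l≢0 l≢1) ⟩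
            transpose 1F J l                                    ≡⟨ transpose-other 1F J l≢1 l≢J ⟩
            l                                                   ∎)))

  sgnProd-transposed-suc : ∀ {k q} {β β′ : Fin (suc k) → Fin q} {i j} → Transposed β β′ (suc i) (suc j) →
                           sgnProd β′ ≡ - sgnProd β
  sgnProd-transposed-suc {β = β} {β′} τ with β′0≡β0 , τ′ ← Transposed-suc τ = begin
    ∏ (λ m → ordSign (β′ zero) (β′ (suc m))) * sgnProd (β′ ∘ suc)
      ≡⟨ cong₂ _*_ (trans (∏-cong (λ m → cong (λ y → ordSign y (β′ (suc m))) β′0≡β0))
                          (∏-transposed (Transposed-∘ (ordSign (β zero)) τ′)))
                   (sgnProd-transposed τ′) ⟩
    ∏ (λ m → ordSign (β zero) (β (suc m))) * - sgnProd (β ∘ suc)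
      ≡⟨ ℤ.neg-distribʳ-* (∏ (λ m → ordSign (β zero) (β (suc m)))) (sgnProd (β ∘ suc)) ⟨
    - sgnProd β ∎
    where open ≡-Reasoning

filter-map-comm : {P : B → Set} {Q : A → Set} (P? : Decidable P) (Q? : Decidable Q) (f : A → B) →
                  (∀ x → does (P? (f x)) ≡ does (Q? x)) → ∀ xs → filter P? (map f xs) ≡ map f (filter Q? xs)
filter-map-comm P? Q? f P∘f≐Q [] = refl
filter-map-comm P? Q? f P∘f≐Q (x ∷ xs) with does (P? (f x)) | does (Q? x) | P∘f≐Q x
... | false | false | refl = filter-map-comm P? Q? f P∘f≐Q xs
... | true  | true  | refl = cong (f x ∷_) (filter-map-comm P? Q? f P∘f≐Q xs)

any-++ : (f : A → Bool) (xs ys : List A) → any f (xs ++ ys) ≡ any f xs ∨ any f ys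
any-++ f [] ys = refl
any-++ f (x ∷ xs) ys = trans (cong (f x ∨_) (any-++ f xs ys)) (sym (Bool.∨-assoc (f x) _ _))

any-map : (f : B → Bool) (g : A → B) (xs : List A) → any f (map g xs) ≡ any (f ∘ g) xs
any-map f g xs = cong or (sym (map-∘ xs))

sucPair : ∀ {k} → Fin k × Fin k → Fin (suc k) × Fin (suc k)
sucPair (l , m) = suc l , suc m

pairsLT-suc : ∀ k → pairsLT (suc k) ≡ map (zero ,_) (map suc (allFin k)) ++ map sucPair (pairsLT k)
pairsLT-suc k = begin
  concatMap row (allFin (suc k))                                  ≡⟨ cong (concatMap row) allFin-suc ⟩
  row zero ++ concatMap row (map suc (allFin k))                  ≡⟨ cong₂ _++_ row-zero (concatMap-map row suc (allFin k)) ⟩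
  map (zero ,_) (map suc (allFin k)) ++ concatMap (row ∘ suc) (allFin k)
    ≡⟨ cong (map (zero ,_) (map suc (allFin k)) ++_) (trans (concatMap-cong row-suc (allFin k)) (sym (map-concatMap sucPair row′ (allFin k)))) ⟩
  map (zero ,_) (map suc (allFin k)) ++ map sucPair (pairsLT k)   ∎
  where
  open ≡-Reasoning
  row : Fin (suc k) → List (Fin (suc k) × Fin (suc k))
  row l = map (l ,_) (filter (l <?_) (allFin (suc k)))
  row′ : Fin k → List (Fin k × Fin k)
  row′ l = map (l ,_) (filter (l <?_) (allFin k))
  allFin-suc : allFin (suc k) ≡ zero ∷ map suc (allFin k)
  allFin-suc = cong (zero ∷_) (sym (map-tabulate id suc))
  row-zero : row zero ≡ map (zero ,_) (map suc (allFin k))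
  row-zero = cong (map (zero ,_)) (trans (cong (filter (zero {n = k} <?_)) allFin-suc)
                                         (filter-all (zero {n = k} <?_) 0<suc))
    where
    0<suc : All (zero {n = k} <_) (map suc (allFin k))
    0<suc = All.map⁺ (All.universal (λ _ → s≤s z≤n) (allFin k))
  row-suc : ∀ l → row (suc l) ≡ map sucPair (row′ l)
  row-suc l = begin
    map (suc l ,_) (filter (suc l <?_) (allFin (suc k)))      ≡⟨ cong (map (suc l ,_) ∘ filter (suc l <?_)) allFin-suc ⟩
    map (suc l ,_) (filter (suc l <?_) (map suc (allFin k)))  ≡⟨ cong (map (suc l ,_)) (filter-map-comm (suc l <?_) (l <?_) suc (λ _ → refl) (allFin k)) ⟩
    map (suc l ,_) (map suc (filter (l <?_) (allFin k)))      ≡⟨ map-∘ (filter (l <?_) (allFin k)) ⟨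
    map (sucPair ∘ (l ,_)) (filter (l <?_) (allFin k))        ≡⟨ map-∘ (filter (l <?_) (allFin k)) ⟩
    map sucPair (row′ l)                                      ∎

length-filter-map : {P : B → Set} (P? : Decidable P) (g : A → B) (xs : List A) →
                    length (filter P? (map g xs)) ≡ length (filter (P? ∘ g) xs)
length-filter-map P? g xs =
  trans (cong length (filter-map-comm P? (P? ∘ g) g (λ _ → refl) xs)) (length-map g (filter (P? ∘ g) xs))

notInjective-suc : ∀ {k q} (β : Fin (suc k) → Fin q) →
  notInjective β ≡ any (λ m → ⌊ β zero Fin.≟ β (suc m) ⌋) (allFin k) ∨ notInjective (β ∘ suc)
notInjective-suc {k} β = begin
  any collide (pairsLT (suc k))
    ≡⟨ cong (any collide) (pairsLT-suc k) ⟩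
  any collide (map (zero ,_) (map suc (allFin k)) ++ map sucPair (pairsLT k))
    ≡⟨ any-++ collide (map (zero ,_) (map suc (allFin k))) (map sucPair (pairsLT k)) ⟩
  any collide (map (zero ,_) (map suc (allFin k))) ∨ any collide (map sucPair (pairsLT k))
    ≡⟨ cong₂ _∨_ (trans (any-map collide (zero ,_) (map suc (allFin k))) (any-map _ suc (allFin k)))
                 (any-map collide sucPair (pairsLT k)) ⟩
  any (λ m → ⌊ β zero Fin.≟ β (suc m) ⌋) (allFin k) ∨ notInjective (β ∘ suc) ∎
  where
  open ≡-Reasoning
  collide : Fin (suc k) × Fin (suc k) → Bool
  collide (l , m) = ⌊ β l Fin.≟ β m ⌋

inversions-suc : ∀ {k q} (β : Fin (suc k) → Fin q) →
  inversions β ≡ length (filter (λ m → β (suc m) <? β zero) (allFin k)) ℕ.+ inversions (β ∘ suc)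
inversions-suc {k} β = begin
  length (filter inverted? (pairsLT (suc k)))
    ≡⟨ cong (length ∘ filter inverted?) (pairsLT-suc k) ⟩
  length (filter inverted? (firstRow ++ map sucPair (pairsLT k)))
    ≡⟨ cong length (filter-++ inverted? firstRow (map sucPair (pairsLT k))) ⟩
  length (filter inverted? firstRow ++ filter inverted? (map sucPair (pairsLT k)))
    ≡⟨ length-++ (filter inverted? firstRow) ⟩
  length (filter inverted? firstRow) ℕ.+ length (filter inverted? (map sucPair (pairsLT k)))
    ≡⟨ cong₂ ℕ._+_ (trans (length-filter-map inverted? (zero ,_) (map suc (allFin k)))
                           (length-filter-map _ suc (allFin k)))
                    (length-filter-map inverted? sucPair (pairsLT k)) ⟩
  length (filter (λ m → β (suc m) <? β zero) (allFin k)) ℕ.+ inversions (β ∘ suc) ∎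
  where
  open ≡-Reasoning
  firstRow : List (Fin (suc k) × Fin (suc k))
  firstRow = map (zero ,_) (map suc (allFin k))
  inverted? : (p : Fin (suc k) × Fin (suc k)) → Dec (β (proj₂ p) < β (proj₁ p))
  inverted? (l , m) = β m <? β l

sgnFrom : Bool → ℕ → ℤ
sgnFrom collision n = if collision then 0ℤ else -1ℤ ^ n

sgnFrom-∨-+ : ∀ a b m n → sgnFrom (a ∨ b) (m ℕ.+ n) ≡ sgnFrom a m * sgnFrom b n
sgnFrom-∨-+ true b m n = refl
sgnFrom-∨-+ false true m n = sym (ℤ.*-zeroʳ (-1ℤ ^ m))
sgnFrom-∨-+ false false m n = ℤ.^-distribˡ-+-* -1ℤ m n

prodℤ-ordSign : ∀ {k q} (b : Fin q) (γ : Fin k → Fin q) (xs : List (Fin k)) →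
  prodℤ (map (ordSign b ∘ γ) xs) ≡ sgnFrom (any (λ m → ⌊ b Fin.≟ γ m ⌋) xs) (length (filter (λ m → γ m <? b) xs))
prodℤ-ordSign b γ [] = refl
prodℤ-ordSign b γ (x ∷ xs) with <-cmp b (γ x) | b Fin.≟ γ x
... | tri≈ _ _ _     | yes _     = refl
... | tri≈ _ b≡γx _  | no b≢γx   = ⊥-elim (b≢γx b≡γx)
... | tri< _ b≢γx _  | yes b≡γx  = ⊥-elim (b≢γx b≡γx)
... | tri> _ b≢γx _  | yes b≡γx  = ⊥-elim (b≢γx b≡γx)
... | tri< b<γx _ _  | no _
  rewrite filter-reject (λ m → γ m <? b) {x} {xs} (Fin.<-asym b<γx) = trans (ℤ.*-identityˡ _) (prodℤ-ordSign b γ xs)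
... | tri> _ _ γx<b  | no _
  rewrite filter-accept (λ m → γ m <? b) {x} {xs} γx<b | prodℤ-ordSign b γ xs
  with any (λ m → ⌊ b Fin.≟ γ m ⌋) xs
...   | true = refl
...   | false = refl

sgn≡sgnProd : ∀ {k q} (β : Fin k → Fin q) → sgn β ≡ sgnProd β
sgn≡sgnProd {zero} β = refl
sgn≡sgnProd {suc k} β = begin
  sgnFrom (notInjective β) (inversions β)
    ≡⟨ cong₂ sgnFrom (notInjective-suc β) (inversions-suc β) ⟩
  sgnFrom (collision₀ ∨ notInjective (β ∘ suc)) (inversions₀ ℕ.+ inversions (β ∘ suc))
    ≡⟨ sgnFrom-∨-+ collision₀ (notInjective (β ∘ suc)) inversions₀ (inversions (β ∘ suc)) ⟩
  sgnFrom collision₀ inversions₀ * sgn (β ∘ suc)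
    ≡⟨ cong₂ _*_ (sym (trans (∏-list (ordSign (β zero) ∘ (β ∘ suc))) (prodℤ-ordSign (β zero) (β ∘ suc) (allFin k))))
                 (sgn≡sgnProd (β ∘ suc)) ⟩
  sgnProd β ∎
  where
  open ≡-Reasoning
  collision₀ : Bool
  collision₀ = any (λ m → ⌊ β zero Fin.≟ β (suc m) ⌋) (allFin k)
  inversions₀ : ℕ
  inversions₀ = length (filter (λ m → β (suc m) <? β zero) (allFin k))

sgn-cong : ∀ {k q} {β γ : Fin k → Fin q} → (∀ i → β i ≡ γ i) → sgn β ≡ sgn γ
sgn-cong {β = β} {γ} β≗γ = trans (sgn≡sgnProd β) (trans (sgnProd-cong β≗γ) (sym (sgn≡sgnProd γ)))

sgn-noninjective : ∀ {k q} (β : Fin k → Fin q) {i j} → i ≢ j → β i ≡ β j → sgn β ≡ 0ℤ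
sgn-noninjective β i≢j βi≡βj = trans (sgn≡sgnProd β) (sgnProd-noninjective β i≢j βi≡βj)

sgn-≢0 : ∀ {k q} (β : Fin k → Fin q) → (∀ i j → β i ≡ β j → i ≡ j) → sgn β ≢ 0ℤ
sgn-≢0 β β-injective = sgnProd-≢0 β β-injective ∘ trans (sym (sgn≡sgnProd β))

sgn-transposed : ∀ {k q} {β β′ : Fin k → Fin q} {i j} → Transposed β β′ i j → sgn β′ ≡ - sgn β
sgn-transposed {β = β} {β′} τ = begin
  sgn β′        ≡⟨ sgn≡sgnProd β′ ⟩
  sgnProd β′    ≡⟨ sgnProd-transposed τ ⟩
  - sgnProd β   ≡⟨ cong -_ (sgn≡sgnProd β) ⟨
  - sgn β       ∎
  where open ≡-Reasoning

module _ {k q : ℕ} (K : Subset q) where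

  φ-cong : {b b′ : Fin k → Fin q} → (∀ i → b i ≡ b′ i) → φ K b ≡ φ K b′
  φ-cong b≗b′ = cong₂ (λ inK s → if inK then s else 0ℤ)
    (cong and (map-cong (λ l → cong (λ y → ⌊ y ∈? K ⌋) (b≗b′ l)) (allFin k))) (sgn-cong b≗b′)

  φ-inside : (b : Fin k → Fin q) → (∀ i → b i ∈ K) → φ K b ≡ sgn b
  φ-inside b b⊆K with all (λ l → ⌊ b l ∈? K ⌋) (allFin k)
                     | all⁻ (λ l → ⌊ b l ∈? K ⌋) (All.universal (λ l → fromWitness (b⊆K l)) (allFin k))
  ... | true | _ = refl

  φ≢0⇒ : (b : Fin k → Fin q) → φ K b ≢ 0ℤ → (∀ i → b i ∈ K) × (∀ i j → b i ≡ b j → i ≡ j)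
  φ≢0⇒ b φ≢0 with all (λ l → ⌊ b l ∈? K ⌋) (allFin k) in inside
  ... | false = ⊥-elim (φ≢0 refl)
  ... | true = b⊆K , b-injective
    where
    b⊆K : ∀ i → b i ∈ K
    b⊆K i = toWitness (All.lookup (all⁺ (λ l → ⌊ b l ∈? K ⌋) (allFin k) (subst T (sym inside) tt)) (∈-allFin i))
    b-injective : ∀ i j → b i ≡ b j → i ≡ j
    b-injective i j bi≡bj with i Fin.≟ j
    ... | yes i≡j = i≡j
    ... | no i≢j = ⊥-elim (φ≢0 (sgn-noninjective b i≢j bi≡bj))

private module FinMod {p : ℕ} where

  q : ℕ
  q = suc p

  toℕ-+q : ∀ (x y : Fin q) → toℕ (x +q y) ≡ (toℕ x ℕ.+ toℕ y) % q
  toℕ-+q x y = toℕ-fromℕ< (m%n<n (toℕ x ℕ.+ toℕ y) q)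

  toℕ--q : ∀ (x : Fin q) → toℕ (-q x) ≡ (q ∸ toℕ x) % q
  toℕ--q x = toℕ-fromℕ< (m%n<n (q ∸ toℕ x) q)

  +q-comm : ∀ (x y : Fin q) → x +q y ≡ y +q x
  +q-comm x y = toℕ-injective (trans (toℕ-+q x y) (trans (cong (_% q) (ℕ.+-comm (toℕ x) (toℕ y))) (sym (toℕ-+q y x))))

  [m+n%d]%d≡[m+n]%d : ∀ m n → (m ℕ.+ n % q) % q ≡ (m ℕ.+ n) % q
  [m+n%d]%d≡[m+n]%d m n = begin
    (m ℕ.+ n % q) % q              ≡⟨ %-distribˡ-+ m (n % q) q ⟩
    (m % q ℕ.+ n % q % q) % q      ≡⟨ cong (λ k → (m % q ℕ.+ k) % q) (m%n%n≡m%n n q) ⟩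
    (m % q ℕ.+ n % q) % q          ≡⟨ %-distribˡ-+ m n q ⟨
    (m ℕ.+ n) % q                  ∎
    where open ≡-Reasoning

  +q-inverseʳ : ∀ (x : Fin q) → toℕ (x +q (-q x)) ≡ 0
  +q-inverseʳ x = begin
    toℕ (x +q (-q x))                       ≡⟨ toℕ-+q x (-q x) ⟩
    (toℕ x ℕ.+ toℕ (-q x)) % q            ≡⟨ cong (λ n → (toℕ x ℕ.+ n) % q) (toℕ--q x) ⟩
    (toℕ x ℕ.+ (q ∸ toℕ x) % q) % q       ≡⟨ [m+n%d]%d≡[m+n]%d (toℕ x) (q ∸ toℕ x) ⟩
    (toℕ x ℕ.+ (q ∸ toℕ x)) % q           ≡⟨ cong (_% q) (ℕ.m+[n∸m]≡n (ℕ.<⇒≤ (toℕ<n x))) ⟩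
    q % q                                 ≡⟨ n%n≡0 q ⟩
    0                                     ∎
    where open ≡-Reasoning

  +q-inverseˡ : ∀ (x : Fin q) → toℕ ((-q x) +q x) ≡ 0
  +q-inverseˡ x = trans (cong toℕ (+q-comm (-q x) x)) (+q-inverseʳ x)

  +q≡0⇒≡-q : ∀ (x y : Fin q) → toℕ (x +q y) ≡ 0 → y ≡ -q x
  +q≡0⇒≡-q x y x+y≡0 with divides c x+y≡c*q ← m%n≡0⇒n∣m (toℕ x ℕ.+ toℕ y) q (trans (sym (toℕ-+q x y)) x+y≡0) =
    toℕ-injective (sym (begin
      toℕ (-q x)                                  ≡⟨ toℕ--q x ⟩
      (q ∸ toℕ x) % q                             ≡⟨ [m+kn]%n≡m%n (q ∸ toℕ x) c q ⟨
      (q ∸ toℕ x ℕ.+ c ℕ.* q) % q                 ≡⟨ cong (λ n → (q ∸ toℕ x ℕ.+ n) % q) x+y≡c*q ⟨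
      (q ∸ toℕ x ℕ.+ (toℕ x ℕ.+ toℕ y)) % q       ≡⟨ cong (_% q) (ℕ.+-assoc (q ∸ toℕ x) (toℕ x) (toℕ y)) ⟨
      (q ∸ toℕ x ℕ.+ toℕ x ℕ.+ toℕ y) % q         ≡⟨ cong (λ n → (n ℕ.+ toℕ y) % q) (ℕ.m∸n+n≡m (ℕ.<⇒≤ (toℕ<n x))) ⟩
      (q ℕ.+ toℕ y) % q                           ≡⟨ cong (_% q) (ℕ.+-comm q (toℕ y)) ⟩
      (toℕ y ℕ.+ q) % q                           ≡⟨ [m+n]%n≡m%n (toℕ y) q ⟩
      toℕ y % q                                   ≡⟨ m<n⇒m%n≡m (toℕ<n y) ⟩
      toℕ y                                       ∎))
    where open ≡-Reasoning

-q-involutive : ∀ {q} (x : Fin q) → -q (-q x) ≡ x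
-q-involutive {suc p} x = sym (FinMod.+q≡0⇒≡-q (-q x) x (FinMod.+q-inverseˡ x))

+q≡0⇒≡-q : ∀ {q} (x y : Fin q) → toℕ (x +q y) ≡ 0 → y ≡ -q x
+q≡0⇒≡-q {suc p} = FinMod.+q≡0⇒≡-q

+q-inverseʳ : ∀ {q} (x : Fin q) → toℕ (x +q (-q x)) ≡ 0
+q-inverseʳ {suc p} = FinMod.+q-inverseʳ

+q-inverseˡ : ∀ {q} (x : Fin q) → toℕ ((-q x) +q x) ≡ 0
+q-inverseˡ {suc p} = FinMod.+q-inverseˡ

≡±⇒≡-q : ∀ {q} {a x y : Fin q} → x ≡ a ⊎ x ≡ -q a → y ≡ a ⊎ y ≡ -q a → x ≢ y → y ≡ -q x
≡±⇒≡-q (inj₁ refl) (inj₁ refl) x≢y = ⊥-elim (x≢y refl)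
≡±⇒≡-q (inj₁ refl) (inj₂ refl) _ = refl
≡±⇒≡-q {a = a} (inj₂ refl) (inj₁ refl) _ = sym (-q-involutive a)
≡±⇒≡-q (inj₂ refl) (inj₂ refl) x≢y = ⊥-elim (x≢y refl)

image : ∀ {k q} → (Fin k → Fin q) → Subset q
image b = Vec.tabulate (λ y → does (any? (λ i → b i Fin.≟ y)))

∈-image⁺ : ∀ {k q} (b : Fin k → Fin q) i → b i ∈ image b
∈-image⁺ b i = lookup⇒[]= (b i) (image b)
  (trans (lookup∘tabulate _ (b i)) (dec-true (any? (λ j → b j Fin.≟ b i)) (i , refl)))

∈-image⁻ : ∀ {k q} (b : Fin k → Fin q) {y} → y ∈ image b → ∃ λ i → b i ≡ y
∈-image⁻ b {y} y∈ with any? (λ i → b i Fin.≟ y) | trans (sym (lookup∘tabulate _ y)) ([]=⇒lookup y∈)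
... | yes hit | _ = hit

∣image∣≥ : ∀ {k q} (b : Fin k → Fin q) → (∀ i j → b i ≡ b j → i ≡ j) → k ℕ.≤ ∣ image b ∣
∣image∣≥ {zero} b _ = z≤n
∣image∣≥ {suc k} b b-injective =
  ℕ.<-≤-trans (s≤s (∣image∣≥ (b ∘ suc) (λ i j bi≡bj → Fin.suc-injective (b-injective (suc i) (suc j) bi≡bj))))
              (p⊂q⇒∣p∣<∣q∣ image-suc⊂image)
  where
  image-suc⊂image : image (b ∘ suc) ⊂ image b
  image-suc⊂image =
    (λ y∈ → let i , bi≡y = ∈-image⁻ (b ∘ suc) y∈ in subst (_∈ image b) bi≡y (∈-image⁺ b (suc i))) ,
    b zero , ∈-image⁺ b zero ,
    λ b0∈ → let i , bi≡b0 = ∈-image⁻ (b ∘ suc) b0∈ in 0≢1+n (b-injective zero (suc i) (sym bi≡b0))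

injective-into-full : ∀ {k q} (K : Subset q) → ∣ K ∣ ≡ k → (b : Fin k → Fin q) → (∀ i → b i ∈ K) →
                      (∀ i j → b i ≡ b j → i ≡ j) → ∀ {y} → y ∈ K → ∃ λ i → b i ≡ y
injective-into-full K ∣K∣≡k b b⊆K b-injective {y} y∈K with any? (λ i → b i Fin.≟ y)
... | yes hit = hit
... | no miss = ⊥-elim (ℕ.<-irrefl refl (begin-strict
  ∣ image b ∣  <⟨ p⊂q⇒∣p∣<∣q∣ image⊂K ⟩
  ∣ K ∣        ≡⟨ ∣K∣≡k ⟩
  _            ≤⟨ ∣image∣≥ b b-injective ⟩
  ∣ image b ∣  ∎))
  where
  open ℕ.≤-Reasoning
  image⊂K : image b ⊂ K
  image⊂K = (λ z∈ → let i , bi≡z = ∈-image⁻ b z∈ in subst (_∈ K) bi≡z (b⊆K i)) , y , y∈K , miss ∘ ∈-image⁻ b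

𝟙[_] : {P : Set} → Dec P → ℕ
𝟙[ P? ] = if does P? then 1 else 0

length-filter-∷ : {P : A → Set} (P? : Decidable P) (x : A) (xs : List A) →
                  length (filter P? (x ∷ xs)) ≡ 𝟙[ P? x ] ℕ.+ length (filter P? xs)
length-filter-∷ P? x xs with P? x
... | yes _ = refl
... | no _ = refl

length-filter-allFin : ∀ {n} {P : Fin n → Set} (P? : Decidable P) → length (filter P? (allFin n)) ≡ ∑[ i < n ] 𝟙[ P? i ]
length-filter-allFin {zero} P? = refl
length-filter-allFin {suc n} P? = trans (length-filter-∷ P? zero (tabulate suc)) (cong (𝟙[ P? zero ] ℕ.+_) rest)
  where
  rest : length (filter P? (tabulate suc)) ≡ ∑[ i < n ] 𝟙[ P? (suc i) ]
  rest = trans (cong (length ∘ filter P?) (sym (map-tabulate id suc)))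
               (trans (length-filter-map P? suc (allFin n)) (length-filter-allFin (P? ∘ suc)))

∑-δ : ∀ {m} (y : Fin m) (g : Fin m → ℕ) → ∑[ e < m ] (𝟙[ y Fin.≟ e ] ℕ.* g e) ≡ g y
∑-δ {suc m} zero g = trans (cong₂ ℕ._+_ (ℕ.*-identityˡ (g zero)) (sum-replicate-zero m)) (ℕ.+-identityʳ (g zero))
∑-δ {suc m} (suc y) g = ∑-δ y (g ∘ suc)

module Reachability {n m q : ℕ} (G : Graph n m) (k : ℕ) (inc : Fin n → Fin k → Fin m)
                    (col : Vec (Fin q) m) (a : Fin q) (u : Fin n) where

  private
    Reached : Fin n → Set
    Reached = Reach G k inc col a u

    StepInto : (Fin n → Bool) → Fin n → Fin m → Set
    StepInto S x e = lookup col e ≡ a × ((proj₂ (ends G e) ≡ x × S (proj₁ (ends G e)) ≡ true) ⊎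
                                          (proj₁ (ends G e) ≡ x × S (proj₂ (ends G e)) ≡ true))

    stepInto? : ∀ S x e → Dec (StepInto S x e)
    stepInto? S x e = (lookup col e Fin.≟ a) ×-dec
      (((proj₂ (ends G e) Fin.≟ x) ×-dec (S (proj₁ (ends G e)) Bool.≟ true)) ⊎-dec
       ((proj₁ (ends G e) Fin.≟ x) ×-dec (S (proj₂ (ends G e)) Bool.≟ true)))

    ball : ℕ → Fin n → Bool
    ball zero x = does (x Fin.≟ u)
    ball (suc t) x = ball t x ∨ does (any? (stepInto? (ball t) x))

    ball-sound : ∀ t x → ball t x ≡ true → Reached x
    ball-sound zero x inBall with x Fin.≟ u | inBall
    ... | yes refl | _ = here
    ball-sound (suc t) x inBall with ball t x in inBall′ | any? (stepInto? (ball t) x)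
    ... | true | _ = ball-sound t x inBall′
    ... | false | yes (e , e∈Fa , inj₁ (e≡wx , w∈)) = step e (ball-sound t _ w∈) e∈Fa (inj₁ (cong₂ _,_ refl e≡wx))
    ... | false | yes (e , e∈Fa , inj₂ (e≡xw , w∈)) = step e (ball-sound t _ w∈) e∈Fa (inj₂ (cong₂ _,_ e≡xw refl))

    ball-suc : ∀ t x → ball t x ≡ true → ball (suc t) x ≡ true
    ball-suc t x inBall rewrite inBall = refl

    ball-mono : ∀ t d x → ball t x ≡ true → ball (d ℕ.+ t) x ≡ true
    ball-mono t zero x inBall = inBall
    ball-mono t (suc d) x inBall = ball-suc (d ℕ.+ t) x (ball-mono t d x inBall)

    ball-complete : ∀ x → Reached x → ∃ λ t → ball t x ≡ true
    ball-complete .u here = 0 , dec-true (u Fin.≟ u) refl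
    ball-complete x (step {w} e r e∈Fa e-ends) with t , w∈ ← ball-complete w r =
      suc t , trans (cong (ball t x ∨_) (dec-true (any? (stepInto? (ball t) x)) (e , e∈Fa , side e-ends))) (Bool.∨-zeroʳ _)
      where
      side : (ends G e ≡ (w , x) ⊎ ends G e ≡ (x , w)) → _
      side (inj₁ e≡wx) = inj₁ (cong proj₂ e≡wx , trans (cong (λ p → ball t (proj₁ p)) e≡wx) w∈)
      side (inj₂ e≡xw) = inj₂ (cong proj₁ e≡xw , trans (cong (λ p → ball t (proj₂ p)) e≡xw) w∈)

    Stable : ℕ → Set
    Stable t = ∀ x → ball (suc t) x ≡ ball t x

    ball-cong : ∀ s t → (∀ x → ball s x ≡ ball t x) → ∀ x → ball (suc s) x ≡ ball (suc t) x
    ball-cong s t s≗t x = cong₂ _∨_ (s≗t x) (dec-cong (any? (stepInto? (ball s) x)) (any? (stepInto? (ball t) x)))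
      where
      transport : ∀ {S S′ : Fin n → Bool} → (∀ y → S y ≡ S′ y) → ∃ (StepInto S x) → ∃ (StepInto S′ x)
      transport S≗S′ (e , e∈Fa , inj₁ (e≡ , y∈)) = e , e∈Fa , inj₁ (e≡ , trans (sym (S≗S′ _)) y∈)
      transport S≗S′ (e , e∈Fa , inj₂ (e≡ , y∈)) = e , e∈Fa , inj₂ (e≡ , trans (sym (S≗S′ _)) y∈)
      dec-cong : (d : Dec (∃ (StepInto (ball s) x))) (d′ : Dec (∃ (StepInto (ball t) x))) → does d ≡ does d′
      dec-cong (yes _) (yes _) = refl
      dec-cong (no _) (no _) = refl
      dec-cong (yes p) (no ¬p′) = ⊥-elim (¬p′ (transport s≗t p))
      dec-cong (no ¬p) (yes p′) = ⊥-elim (¬p (transport (sym ∘ s≗t) p′))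

    ball-stable-forever : ∀ t → Stable t → ∀ d x → ball (d ℕ.+ t) x ≡ ball t x
    ball-stable-forever t stable zero x = refl
    ball-stable-forever t stable (suc d) x = trans (ball-cong (d ℕ.+ t) t (ball-stable-forever t stable d) x) (stable x)

    ballSet : ℕ → Subset n
    ballSet t = Vec.tabulate (ball t)

    ∈-ballSet⁺ : ∀ {t x} → ball t x ≡ true → x ∈ ballSet t
    ∈-ballSet⁺ {t} {x} x∈ = lookup⇒[]= x (ballSet t) (trans (lookup∘tabulate (ball t) x) x∈)

    ∈-ballSet⁻ : ∀ {t x} → x ∈ ballSet t → ball t x ≡ true
    ∈-ballSet⁻ {t} {x} x∈ = trans (sym (lookup∘tabulate (ball t) x)) ([]=⇒lookup x∈)

    ballSet-⊂ : ∀ t → ¬ Stable t → ballSet t ⊂ ballSet (suc t)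
    ballSet-⊂ t unstable with x , changed ← ¬∀⟶∃¬ n _ (λ x → ball (suc t) x Bool.≟ ball t x) unstable =
      (λ y∈ → ∈-ballSet⁺ {suc t} (ball-suc t _ (∈-ballSet⁻ {t} y∈))) ,
      x , ∈-ballSet⁺ {suc t} (proj₂ new) , λ x∈ → false≢true (trans (sym (proj₁ new)) (∈-ballSet⁻ {t} x∈))
      where
      new : ball t x ≡ false × ball (suc t) x ≡ true
      new = increased (ball-suc t x) changed
        where
        increased : ∀ {b b′} → (b ≡ true → b′ ≡ true) → b′ ≢ b → b ≡ false × b′ ≡ true
        increased {false} {true} _ _ = refl , refl
        increased {false} {false} _ b′≢b = ⊥-elim (b′≢b refl)
        increased {true} {true} _ b′≢b = ⊥-elim (b′≢b refl)
        increased {true} {false} b⇒b′ _ = ⊥-elim (false≢true (b⇒b′ refl))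

    ballSet-growth : ∀ t → t ℕ.≤ ∣ ballSet t ∣ ⊎ ∃ λ s → s ℕ.< t × Stable s
    ballSet-growth zero = inj₁ z≤n
    ballSet-growth (suc t) with ballSet-growth t
    ... | inj₂ (s , s<t , stable) = inj₂ (s , ℕ.m≤n⇒m≤1+n s<t , stable)
    ... | inj₁ t≤∣ball∣ with all? (λ x → ball (suc t) x Bool.≟ ball t x)
    ...   | yes stable = inj₂ (t , ℕ.≤-refl , stable)
    ...   | no unstable = inj₁ (ℕ.<-≤-trans (s≤s t≤∣ball∣) (p⊂q⇒∣p∣<∣q∣ (ballSet-⊂ t unstable)))

    ball-stabilises : ∃ λ s → s ℕ.≤ n × Stable s
    ball-stabilises with ballSet-growth (suc n)
    ... | inj₁ 1+n≤∣ball∣ = ⊥-elim (ℕ.<-irrefl refl (ℕ.≤-trans 1+n≤∣ball∣ (∣p∣≤n (ballSet (suc n)))))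
    ... | inj₂ (s , s<1+n , stable) = s , ℕ.≤-pred s<1+n , stable

    ball-max : ∀ t x → ball t x ≡ true → ball n x ≡ true
    ball-max t x x∈ with s , s≤n , stable ← ball-stabilises | ℕ.≤-total t s
    ... | inj₁ t≤s = ball-mono-≤ (ℕ.≤-trans t≤s s≤n) x∈
      where
      ball-mono-≤ : ∀ {t′ t″} → t′ ℕ.≤ t″ → ball t′ x ≡ true → ball t″ x ≡ true
      ball-mono-≤ {t′} t′≤t″ with d , refl ← ℕ.m≤n⇒∃[o]m+o≡n t′≤t″ =
        subst (λ t″ → ball t″ x ≡ true) (ℕ.+-comm d t′) ∘ ball-mono t′ d x
    ... | inj₂ s≤t with d , refl ← ℕ.m≤n⇒∃[o]m+o≡n s≤t | d′ , refl ← ℕ.m≤n⇒∃[o]m+o≡n s≤n =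
      subst (λ t → ball t x ≡ true) (ℕ.+-comm d′ s) (ball-mono s d′ x
        (trans (sym (ball-stable-forever s stable d x)) (subst (λ t → ball t x ≡ true) (ℕ.+-comm s d) x∈)))

  reach? : ∀ x → Dec (Reached x)
  reach? x with ball n x in x∈
  ... | true = yes (ball-sound n x x∈)
  ... | false = no λ r → let t , x∈′ = ball-complete x r in false≢true (trans (sym x∈) (ball-max t x x∈′))

module HalfEdges {n m : ℕ} (G : Graph n m) (k : ℕ) (inc : Fin n → Fin k → Fin m) (ho : HalfEdgeOrder G k inc) where

  u₁ u₂ : Fin m → Fin n
  u₁ e = proj₁ (ends G e)
  u₂ e = proj₂ (ends G e)

  inc-injective : ∀ v i j → inc v i ≡ inc v j → i ≡ j
  inc-injective = proj₁ ho

  inc-incident : ∀ v i → Incident G v (inc v i)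
  inc-incident v i = proj₂ (proj₂ ho v (inc v i)) (i , refl)

  slot₁ slot₂ : Fin m → Fin k
  slot₁ e = proj₁ (proj₁ (proj₂ ho (u₁ e) e) (inj₁ refl))
  slot₂ e = proj₁ (proj₁ (proj₂ ho (u₂ e) e) (inj₂ refl))

  inc-slot₁ : ∀ e → inc (u₁ e) (slot₁ e) ≡ e
  inc-slot₁ e = proj₂ (proj₁ (proj₂ ho (u₁ e) e) (inj₁ refl))

  inc-slot₂ : ∀ e → inc (u₂ e) (slot₂ e) ≡ e
  inc-slot₂ e = proj₂ (proj₁ (proj₂ ho (u₂ e) e) (inj₂ refl))

  ∑-half-edges : ∀ e → ∑[ v < n ] ∑[ i < k ] 𝟙[ inc v i Fin.≟ e ] ≡ 2
  ∑-half-edges e = begin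
    ∑[ v < n ] ∑[ i < k ] 𝟙[ inc v i Fin.≟ e ]                     ≡⟨ sum-cong-≗ (λ v → sym (length-filter-allFin (λ i → inc v i Fin.≟ e))) ⟩
    ∑[ v < n ] length (filter (λ i → inc v i Fin.≟ e) (allFin k))  ≡⟨ sum-cong-≗ slots ⟩
    ∑[ v < n ] 𝟙[ incident? v ]                                    ≡⟨ length-filter-allFin incident? ⟨
    length (filter incident? (allFin n))                           ≡⟨ Enumerates-length (Enumerates-filter-allFin incident?) endpoints ⟩
    2                                                              ∎
    where
    open ≡-Reasoning
    incident? : ∀ v → Dec (Incident G v e)
    incident? v = (u₁ e Fin.≟ v) ⊎-dec (u₂ e Fin.≟ v)
    endpoints : Enumerates (λ v → Incident G v e) (u₁ e ∷ u₂ e ∷ [])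
    endpoints = Enumerates-pair (u₁ e) (u₂ e) (loopless G e) (inj₁ refl) (inj₂ refl) λ _ → Sum.map sym sym
    slots : ∀ v → length (filter (λ i → inc v i Fin.≟ e) (allFin k)) ≡ 𝟙[ incident? v ]
    slots v = count (incident? v)
      where
      count : (v∈e? : Dec (Incident G v e)) → length (filter (λ i → inc v i Fin.≟ e) (allFin k)) ≡ 𝟙[ v∈e? ]
      count (yes v∈e) with i , inc-i≡e ← proj₁ (proj₂ ho v e) v∈e =
        Enumerates-length (Enumerates-filter-allFin _)
                          (Enumerates-[ i ] inc-i≡e (λ j inc-j≡e → inc-injective v j i (trans inc-j≡e (sym inc-i≡e))))
      count (no v∉e) = Enumerates-length (Enumerates-filter-allFin _) (Enumerates-[] (λ i inc-i≡e → v∉e (proj₂ (proj₂ ho v e) (i , inc-i≡e))))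

module Component {n m q : ℕ} (G : Graph n m) (k : ℕ) (inc : Fin n → Fin k → Fin m) (ho : HalfEdgeOrder G k inc)
                 (col : Vec (Fin q) m) (a : Fin q) (u : Fin n) where

  open HalfEdges G k inc ho
  open Reachability G k inc col a u using (reach?) public

  Reached : Fin n → Set
  Reached = Reach G k inc col a u

  InComponent : Fin m → Set
  InComponent e = lookup col e ≡ a × Reached (u₁ e)

  inComponent? : ∀ e → Dec (InComponent e)
  inComponent? e = (lookup col e Fin.≟ a) ×-dec reach? (u₁ e)

  inComponent⁺ : ∀ v i → lookup col (inc v i) ≡ a → Reached v → InComponent (inc v i)
  inComponent⁺ v i coloured reached with inc-incident v i
  ... | inj₁ u₁≡v = coloured , subst Reached (sym u₁≡v) reached
  ... | inj₂ u₂≡v = coloured , step (inc v i) reached coloured (inj₂ (cong (u₁ (inc v i) ,_) u₂≡v))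

  inComponent⁻ : ∀ v i → InComponent (inc v i) → Reached v
  inComponent⁻ v i (coloured , reached) with inc-incident v i
  ... | inj₁ u₁≡v = subst Reached u₁≡v reached
  ... | inj₂ u₂≡v = step (inc v i) reached coloured (inj₁ (cong (u₁ (inc v i) ,_) u₂≡v))

  module _ (2-regular : ∀ v → degA G k inc col v a ≡ 2) where

    ∑-component-slots : ∀ v → 𝟙[ reach? v ] ℕ.* 2 ≡ ∑[ i < k ] 𝟙[ inComponent? (inc v i) ]
    ∑-component-slots v = trans (count (reach? v)) (length-filter-allFin (inComponent? ∘ inc v))
      where
      slots : Enumerates (InComponent ∘ inc v) (filter (inComponent? ∘ inc v) (allFin k))
      slots = Enumerates-filter-allFin (inComponent? ∘ inc v)
      count : (reached? : Dec (Reached v)) → 𝟙[ reached? ] ℕ.* 2 ≡ length (filter (inComponent? ∘ inc v) (allFin k))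
      count (yes reached) = trans (sym (2-regular v)) (Enumerates-length
        (Enumerates-resp (λ i coloured → inComponent⁺ v i coloured reached) (λ _ → proj₁)
                         (Enumerates-filter-allFin (λ i → lookup col (inc v i) Fin.≟ a))) slots)
      count (no unreached) = Enumerates-length (Enumerates-[] (λ i → unreached ∘ inComponent⁻ v i)) slots

    -- Double counting of the half-edges of the component: two at each of its vertices, two on each of its edges.
    handshake : length (filter reach? (allFin n)) ≡ length (filter inComponent? (allFin m))
    handshake = ℕ.*-cancelʳ-≡ _ _ 2 (begin
      length (filter reach? (allFin n)) ℕ.* 2                  ≡⟨ cong (ℕ._* 2) (length-filter-allFin reach?) ⟩
      (∑[ v < n ] 𝟙[ reach? v ]) ℕ.* 2                         ≡⟨ *-distribʳ-sum 2 (λ v → 𝟙[ reach? v ]) ⟩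
      ∑[ v < n ] (𝟙[ reach? v ] ℕ.* 2)                         ≡⟨ sum-cong-≗ ∑-component-slots ⟩
      ∑[ v < n ] ∑[ i < k ] 𝟙[ inComponent? (inc v i) ]        ≡⟨ sum-cong-≗ (λ v → sum-cong-≗ (λ i → sym (∑-δ (inc v i) χ))) ⟩
      ∑[ v < n ] ∑[ i < k ] ∑[ e < m ] halfEdge v i e          ≡⟨ sum-cong-≗ (λ v → ∑-comm (halfEdge v)) ⟩
      ∑[ v < n ] ∑[ e < m ] ∑[ i < k ] halfEdge v i e          ≡⟨ ∑-comm (λ v e → ∑[ i < k ] halfEdge v i e) ⟩
      ∑[ e < m ] ∑[ v < n ] ∑[ i < k ] halfEdge v i e
        ≡⟨ sum-cong-≗ (λ e → sum-cong-≗ (λ v → sym (*-distribʳ-sum (χ e) (λ i → 𝟙[ inc v i Fin.≟ e ])))) ⟩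
      ∑[ e < m ] ∑[ v < n ] ((∑[ i < k ] 𝟙[ inc v i Fin.≟ e ]) ℕ.* χ e)
        ≡⟨ sum-cong-≗ (λ e → sym (*-distribʳ-sum (χ e) (λ v → ∑[ i < k ] 𝟙[ inc v i Fin.≟ e ]))) ⟩
      ∑[ e < m ] ((∑[ v < n ] ∑[ i < k ] 𝟙[ inc v i Fin.≟ e ]) ℕ.* χ e)
                                                               ≡⟨ sum-cong-≗ (λ e → trans (cong (ℕ._* χ e) (∑-half-edges e)) (ℕ.*-comm 2 (χ e))) ⟩
      ∑[ e < m ] (χ e ℕ.* 2)                                   ≡⟨ *-distribʳ-sum 2 χ ⟨
      (∑[ e < m ] χ e) ℕ.* 2                                   ≡⟨ cong (ℕ._* 2) (length-filter-allFin inComponent?) ⟨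
      length (filter inComponent? (allFin m)) ℕ.* 2            ∎)
      where
      open ≡-Reasoning
      χ : Fin m → ℕ
      χ e = 𝟙[ inComponent? e ]
      halfEdge : Fin n → Fin k → Fin m → ℕ
      halfEdge v i e = 𝟙[ inc v i Fin.≟ e ] ℕ.* χ e

module Factorizations {n m q : ℕ} (G : Graph n m) (k : ℕ) (inc : Fin n → Fin k → Fin m) (ho : HalfEdgeOrder G k inc)
  (K P : Subset q) (∣K∣≡k : ∣ K ∣ ≡ k) (-K⊆K : ∀ x → x ∈ K → -q x ∈ K)
  (K⊆P∪-P : ∀ y → y ∈ K → y ∈ P ⊎ y ∈- P) (P∪-P⊆K : ∀ y → y ∈ P ⊎ y ∈- P → y ∈ K)
  (P∩-P-selfInverse : ∀ y → y ∈ P → y ∈- P → y ≡ -q y) where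

  open HalfEdges G k inc ho

  Labelling : Set
  Labelling = Vec (Vec (Fin q) k) n

  Oriented : Set
  Oriented = Vec (Fin q) m × Vec Bool m

  headOf′ tailOf′ : Vec Bool m → Fin m → Fin n
  headOf′ = headOf {q = q} G k inc
  tailOf′ = tailOf {q = q} G k inc

  -- the oriented (near) 2-factorizations indexed by P, without the bipartiteness condition
  record IsOrientedFactorization (F : Oriented) : Set where
    field
      colour∈P : ∀ e → lookup (proj₁ F) e ∈ P
      degree : ∀ a → a ∈ P → ∀ v → (a ≡ -q a → degA G k inc (proj₁ F) v a ≡ 1) × (¬ a ≡ -q a → degA G k inc (proj₁ F) v a ≡ 2)
      in-out-degree : ∀ a → a ∈ P → ¬ a ≡ -q a → ∀ v →
                      inDegA G k inc (proj₁ F) (proj₂ F) v a ≡ 1 × outDegA G k inc (proj₁ F) (proj₂ F) v a ≡ 1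
      undirected : ∀ e → lookup (proj₁ F) e ≡ -q lookup (proj₁ F) e → lookup (proj₂ F) e ≡ false

  P⊆K : ∀ {a} → a ∈ P → a ∈ K
  P⊆K a∈P = P∪-P⊆K _ (inj₁ a∈P)

  -P⊆K : ∀ {a} → a ∈ P → -q a ∈ K
  -P⊆K a∈P = -K⊆K _ (P⊆K a∈P)

  -- the colour a ∈ P with x ∈ {a, -a}
  rep : Fin q → Fin q
  rep x with x ∈? P
  ... | yes _ = x
  ... | no _ = -q x

  rep-∈P : ∀ {x} → x ∈ K → rep x ∈ P
  rep-∈P {x} x∈K with x ∈? P
  ... | yes x∈P = x∈P
  ... | no x∉P with K⊆P∪-P x x∈K
  ...   | inj₁ x∈P = ⊥-elim (x∉P x∈P)
  ...   | inj₂ (y , y∈P , refl) = subst (_∈ P) (sym (-q-involutive y)) y∈P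

  rep-unique : ∀ {a} x → a ∈ P → x ≡ a ⊎ x ≡ -q a → rep x ≡ a
  rep-unique x a∈P x≡±a with x ∈? P | x≡±a
  ... | yes _ | inj₁ x≡a = x≡a
  ... | yes x∈P | inj₂ x≡-a = trans (P∩-P-selfInverse x x∈P (_ , a∈P , x≡-a)) (trans (cong -q_ x≡-a) (-q-involutive _))
  ... | no x∉P | inj₁ refl = ⊥-elim (x∉P a∈P)
  ... | no _ | inj₂ refl = -q-involutive _

  ≡±rep : ∀ x → x ≡ rep x ⊎ x ≡ -q rep x
  ≡±rep x with x ∈? P
  ... | yes _ = inj₁ refl
  ... | no _ = inj₂ (sym (-q-involutive x))

  signed : Fin q → Bool → Fin q
  signed a into = if into then a else -q a

  signed-rep : ∀ x → signed (rep x) ⌊ x Fin.≟ rep x ⌋ ≡ x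
  signed-rep x with x Fin.≟ rep x | ≡±rep x
  ... | yes x≡r | _ = sym x≡r
  ... | no x≢r | inj₁ x≡r = ⊥-elim (x≢r x≡r)
  ... | no _ | inj₂ x≡-r = sym x≡-r

  signed-rep-not : ∀ x → signed (rep x) (not ⌊ x Fin.≟ rep x ⌋) ≡ -q x
  signed-rep-not x with x Fin.≟ rep x | ≡±rep x
  ... | yes x≡r | _ = cong -q_ (sym x≡r)
  ... | no x≢r | inj₁ x≡r = ⊥-elim (x≢r x≡r)
  ... | no _ | inj₂ x≡-r = trans (sym (-q-involutive (rep x))) (cong -q_ (sym x≡-r))

  rep-selfInverse : ∀ x → rep x ≡ -q rep x → x ≡ rep x
  rep-selfInverse x r≡-r with ≡±rep x
  ... | inj₁ x≡r = x≡r
  ... | inj₂ x≡-r = trans x≡-r (sym r≡-r)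

  signed-± : ∀ a into → signed a into ≡ a ⊎ signed a into ≡ -q a
  signed-± a true = inj₁ refl
  signed-± a false = inj₂ refl

  tail⇒¬head : ∀ dir {v} e → tailOf′ dir e ≡ v → headOf′ dir e ≢ v
  tail⇒¬head dir e with lookup dir e
  ... | true = λ u₂≡v u₁≡v → loopless G e (trans u₁≡v (sym u₂≡v))
  ... | false = λ u₁≡v u₂≡v → loopless G e (trans u₁≡v (sym u₂≡v))

  ¬head⇒tail : ∀ dir {v e} → Incident G v e → headOf′ dir e ≢ v → tailOf′ dir e ≡ v
  ¬head⇒tail dir {e = e} v∈e with lookup dir e | v∈e
  ... | true | inj₁ u₁≡v = λ u₁≢v → ⊥-elim (u₁≢v u₁≡v)
  ... | true | inj₂ u₂≡v = λ _ → u₂≡v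
  ... | false | inj₁ u₁≡v = λ _ → u₁≡v
  ... | false | inj₂ u₂≡v = λ u₂≢v → ⊥-elim (u₂≢v u₂≡v)

  module _ (col : Vec (Fin q) m) (dir : Vec Bool m) (v : Fin n) (i : Fin k) where

    wHalf-selfInverse : ∀ {e} → inc v i ≡ e → lookup col e ≡ -q lookup col e → wHalf G k inc col dir v i ≡ lookup col e
    wHalf-selfInverse refl a≡-a with lookup col (inc v i) Fin.≟ -q lookup col (inc v i)
    ... | yes _ = refl
    ... | no a≢-a = ⊥-elim (a≢-a a≡-a)

    wHalf-signed : ∀ {e} → inc v i ≡ e → ¬ lookup col e ≡ -q lookup col e →
                   wHalf G k inc col dir v i ≡ signed (lookup col e) ⌊ headOf′ dir e Fin.≟ v ⌋
    wHalf-signed refl a≢-a with lookup col (inc v i) Fin.≟ -q lookup col (inc v i)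
    ... | yes a≡-a = ⊥-elim (a≢-a a≡-a)
    ... | no _ = refl

    wHalf-± : ∀ {e} → inc v i ≡ e → wHalf G k inc col dir v i ≡ lookup col e ⊎ wHalf G k inc col dir v i ≡ -q lookup col e
    wHalf-± refl = cases (lookup col (inc v i) Fin.≟ -q lookup col (inc v i))
      where
      cases : Dec (lookup col (inc v i) ≡ -q lookup col (inc v i)) →
              wHalf G k inc col dir v i ≡ lookup col (inc v i) ⊎ wHalf G k inc col dir v i ≡ -q lookup col (inc v i)
      cases (yes a≡-a) = inj₁ (wHalf-selfInverse refl a≡-a)
      cases (no a≢-a) = Sum.map (trans (wHalf-signed refl a≢-a)) (trans (wHalf-signed refl a≢-a)) (signed-± _ _)

    private
      w a : Fin q
      w = wHalf G k inc col dir v i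
      a = lookup col (inc v i)

    wHalf-±⇒colour : ∀ {b} → b ∈ P → a ∈ P → w ≡ b ⊎ w ≡ -q b → a ≡ b
    wHalf-±⇒colour b∈P a∈P w≡±b = trans (sym (rep-unique w a∈P (wHalf-± refl))) (rep-unique w b∈P w≡±b)

    into⇒wHalf≡ : ¬ a ≡ -q a → headOf′ dir (inc v i) ≡ v → w ≡ a
    into⇒wHalf≡ a≢-a into = trans (wHalf-signed refl a≢-a) (cong (signed a) (⌊⌋-true (headOf′ dir (inc v i) Fin.≟ v) into))

    outOf⇒wHalf≡- : ¬ a ≡ -q a → tailOf′ dir (inc v i) ≡ v → w ≡ -q a
    outOf⇒wHalf≡- a≢-a out = trans (wHalf-signed refl a≢-a)
      (cong (signed a) (⌊⌋-false (headOf′ dir (inc v i) Fin.≟ v) (tail⇒¬head dir (inc v i) out)))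

    wHalf≡⇒into : ¬ a ≡ -q a → w ≡ a → headOf′ dir (inc v i) ≡ v
    wHalf≡⇒into a≢-a w≡a = into? (headOf′ dir (inc v i) Fin.≟ v) (trans (sym (wHalf-signed refl a≢-a)) w≡a)
      where
      into? : (d : Dec (headOf′ dir (inc v i) ≡ v)) → signed a ⌊ d ⌋ ≡ a → headOf′ dir (inc v i) ≡ v
      into? (yes into) _ = into
      into? (no _) -a≡a = ⊥-elim (a≢-a (sym -a≡a))

    wHalf≡-⇒outOf : ¬ a ≡ -q a → w ≡ -q a → tailOf′ dir (inc v i) ≡ v
    wHalf≡-⇒outOf a≢-a w≡-a = ¬head⇒tail dir (inc-incident v i) (into? (headOf′ dir (inc v i) Fin.≟ v) (trans (sym (wHalf-signed refl a≢-a)) w≡-a))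
      where
      into? : (d : Dec (headOf′ dir (inc v i) ≡ v)) → signed a ⌊ d ⌋ ≡ -q a → headOf′ dir (inc v i) ≢ v
      into? (yes _) a≡-a = ⊥-elim (a≢-a a≡-a)
      into? (no out) _ = out

  head≟u₁ : ∀ dir e → ⌊ headOf′ dir e Fin.≟ u₁ e ⌋ ≡ lookup dir e
  head≟u₁ dir e with lookup dir e
  ... | true = ⌊⌋-true (u₁ e Fin.≟ u₁ e) refl
  ... | false = ⌊⌋-false (u₂ e Fin.≟ u₁ e) (loopless G e ∘ sym)

  head≟u₂ : ∀ dir e → ⌊ headOf′ dir e Fin.≟ u₂ e ⌋ ≡ not (lookup dir e)
  head≟u₂ dir e with lookup dir e
  ... | true = ⌊⌋-false (u₁ e Fin.≟ u₂ e) (loopless G e)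
  ... | false = ⌊⌋-true (u₂ e Fin.≟ u₂ e) refl

  signed-+q-not : ∀ a into → toℕ (signed a into +q signed a (not into)) ≡ 0
  signed-+q-not a true = +q-inverseʳ a
  signed-+q-not a false = +q-inverseˡ a

  label : Labelling → Fin n → Fin k → Fin q
  label z v i = lookup (lookup z v) i

  label₁ : Labelling → Fin m → Fin q
  label₁ z e = label z (u₁ e) (slot₁ e)

  NonVanishing : Labelling → Set
  NonVanishing z = ∀ v → φ K (label z v) ≢ 0ℤ

  labelling : Oriented → Labelling
  labelling (col , dir) = Vec.tabulate (λ v → Vec.tabulate (wHalf G k inc col dir v))

  -- e gets the colour a ∈ P with z(u₁,e) = ±a, and is directed into u₁ iff z(u₁,e) = a ≠ -a.
  factorization : Labelling → Oriented
  factorization z =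
    Vec.tabulate (λ e → rep (label₁ z e)) ,
    Vec.tabulate (λ e → ⌊ label₁ z e Fin.≟ rep (label₁ z e) ⌋ ∧ not ⌊ rep (label₁ z e) Fin.≟ -q rep (label₁ z e) ⌋)

  label-labelling : ∀ col dir v i → label (labelling (col , dir)) v i ≡ wHalf G k inc col dir v i
  label-labelling col dir v i = trans (cong (λ l → lookup l i) (lookup∘tabulate _ v)) (lookup∘tabulate _ i)

  module OfFactorization (col : Vec (Fin q) m) (dir : Vec Bool m) (fact : IsOrientedFactorization (col , dir)) where

    open IsOrientedFactorization fact

    private
      β : Fin n → Fin k → Fin q
      β = wHalf G k inc col dir


    labelling-∈K : ∀ v i → β v i ∈ K
    labelling-∈K v i with wHalf-± col dir v i refl
    ... | inj₁ βvi≡a = subst (_∈ K) (sym βvi≡a) (P⊆K (colour∈P (inc v i)))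
    ... | inj₂ βvi≡-a = subst (_∈ K) (sym βvi≡-a) (-P⊆K (colour∈P (inc v i)))

    labelling-injective : ∀ v i j → β v i ≡ β v j → i ≡ j
    labelling-injective v i j βvi≡βvj = cases (a Fin.≟ -q a)
      where
      a a′ : Fin q
      a = lookup col (inc v i)
      a′ = lookup col (inc v j)
      a′≡a : a′ ≡ a
      a′≡a = begin
        a′             ≡⟨ rep-unique (β v j) (colour∈P (inc v j)) (wHalf-± col dir v j refl) ⟨
        rep (β v j)    ≡⟨ cong rep βvi≡βvj ⟨
        rep (β v i)    ≡⟨ rep-unique (β v i) (colour∈P (inc v i)) (wHalf-± col dir v i refl) ⟩
        a              ∎
        where open ≡-Reasoning
      cases : Dec (a ≡ -q a) → i ≡ j
      cases (yes a≡-a) =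
        Enumerates-length≡1⇒unique (Enumerates-filter-allFin _) (proj₁ (degree a (colour∈P (inc v i)) v) a≡-a) refl a′≡a
      cases (no a≢-a) = by-direction (headOf′ dir (inc v i) Fin.≟ v) (headOf′ dir (inc v j) Fin.≟ v)
                                     (wHalf-signed col dir v i refl a≢-a)
                                     (wHalf-signed col dir v j refl (subst (λ b → ¬ b ≡ -q b) (sym a′≡a) a≢-a))
        where
        in-out : inDegA G k inc col dir v a ≡ 1 × outDegA G k inc col dir v a ≡ 1
        in-out = in-out-degree a (colour∈P (inc v i)) a≢-a v
        by-direction : (into-i : Dec (headOf′ dir (inc v i) ≡ v)) (into-j : Dec (headOf′ dir (inc v j) ≡ v)) →
                       β v i ≡ signed a ⌊ into-i ⌋ → β v j ≡ signed a′ ⌊ into-j ⌋ → i ≡ j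
        by-direction (yes into-i) (yes into-j) _ _ =
          Enumerates-length≡1⇒unique (Enumerates-filter-allFin _) (proj₁ in-out) (refl , into-i) (a′≡a , into-j)
        by-direction (no out-i) (no out-j) _ _ =
          Enumerates-length≡1⇒unique (Enumerates-filter-allFin _) (proj₂ in-out)
            (refl , ¬head⇒tail dir (inc-incident v i) out-i) (a′≡a , ¬head⇒tail dir (inc-incident v j) out-j)
        by-direction (yes _) (no _) βvi≡a βvj≡-a′ = ⊥-elim (a≢-a (trans (sym βvi≡a) (trans βvi≡βvj (trans βvj≡-a′ (cong -q_ a′≡a)))))
        by-direction (no _) (yes _) βvi≡-a βvj≡a′ = ⊥-elim (a≢-a (trans (sym a′≡a) (trans (sym βvj≡a′) (trans (sym βvi≡βvj) βvi≡-a))))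

    labelling-admissible : Admissible G k inc (labelling (col , dir))
    labelling-admissible e i j i↦e j↦e = begin
      toℕ (label z (u₁ e) i +q label z (u₂ e) j)
        ≡⟨ cong₂ (λ x y → toℕ (x +q y)) (label-labelling col dir (u₁ e) i) (label-labelling col dir (u₂ e) j) ⟩
      toℕ (β (u₁ e) i +q β (u₂ e) j)               ≡⟨ cases (lookup col e Fin.≟ -q lookup col e) ⟩
      0                                            ∎
      where
      open ≡-Reasoning
      z : Labelling
      z = labelling (col , dir)
      a : Fin q
      a = lookup col e
      cases : Dec (a ≡ -q a) → toℕ (β (u₁ e) i +q β (u₂ e) j) ≡ 0
      cases (yes a≡-a) =
        trans (cong₂ (λ x y → toℕ (x +q y)) (wHalf-selfInverse col dir (u₁ e) i i↦e a≡-a)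
                                            (trans (wHalf-selfInverse col dir (u₂ e) j j↦e a≡-a) a≡-a))
              (+q-inverseʳ a)
      cases (no a≢-a) =
        trans (cong₂ (λ x y → toℕ (x +q y)) (trans (wHalf-signed col dir (u₁ e) i i↦e a≢-a) (cong (signed a) (head≟u₁ dir e)))
                                            (trans (wHalf-signed col dir (u₂ e) j j↦e a≢-a) (cong (signed a) (head≟u₂ dir e))))
              (signed-+q-not a (lookup dir e))

    labelling-nonvanishing : NonVanishing (labelling (col , dir))
    labelling-nonvanishing v φ≡0 = sgn-≢0 (β v) (labelling-injective v)
      (trans (sym (φ-inside K (β v) (labelling-∈K v))) (trans (φ-cong K (λ i → sym (label-labelling col dir v i))) φ≡0))

    factorization∘labelling : factorization (labelling (col , dir)) ≡ (col , dir)
    factorization∘labelling = cong₂ _,_ (Vec-ext col rep-label₁) (Vec-ext dir direction)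
      where
      x : Fin m → Fin q
      x e = label₁ (labelling (col , dir)) e
      x≡β : ∀ e → x e ≡ β (u₁ e) (slot₁ e)
      x≡β e = label-labelling col dir (u₁ e) (slot₁ e)
      rep-label₁ : ∀ e → rep (x e) ≡ lookup col e
      rep-label₁ e = rep-unique (x e) (colour∈P e) (subst (λ y → y ≡ lookup col e ⊎ y ≡ -q lookup col e) (sym (x≡β e))
                                                       (wHalf-± col dir (u₁ e) (slot₁ e) (inc-slot₁ e)))
      direction : ∀ e → ⌊ x e Fin.≟ rep (x e) ⌋ ∧ not ⌊ rep (x e) Fin.≟ -q rep (x e) ⌋ ≡ lookup dir e
      direction e rewrite rep-label₁ e with lookup col e Fin.≟ -q lookup col e
      ... | yes a≡-a = trans (Bool.∧-zeroʳ _) (sym (undirected e a≡-a))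
      ... | no a≢-a rewrite x≡β e | wHalf-signed col dir (u₁ e) (slot₁ e) (inc-slot₁ e) a≢-a | head≟u₁ dir e =
        trans (Bool.∧-identityʳ _) (signed≟ (lookup dir e))
        where
        signed≟ : ∀ into → ⌊ signed (lookup col e) into Fin.≟ lookup col e ⌋ ≡ into
        signed≟ true = ⌊⌋-true (lookup col e Fin.≟ lookup col e) refl
        signed≟ false = ⌊⌋-false (-q lookup col e Fin.≟ lookup col e) (a≢-a ∘ sym)

  module OfAdmissible (z : Labelling) (admissible : Admissible G k inc z) where

    private
      col : Vec (Fin q) m
      col = proj₁ (factorization z)
      dir : Vec Bool m
      dir = proj₂ (factorization z)
      x : Fin m → Fin q
      x = label₁ z

    colour : ∀ e → lookup col e ≡ rep (x e)
    colour e = lookup∘tabulate _ e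

    direction : ∀ e → lookup dir e ≡ ⌊ x e Fin.≟ rep (x e) ⌋ ∧ not ⌊ rep (x e) Fin.≟ -q rep (x e) ⌋
    direction e = lookup∘tabulate _ e

    direction-nonSelfInverse : ∀ e → ¬ rep (x e) ≡ -q rep (x e) → lookup dir e ≡ ⌊ x e Fin.≟ rep (x e) ⌋
    direction-nonSelfInverse e r≢-r =
      trans (direction e) (trans (cong (λ b → ⌊ x e Fin.≟ rep (x e) ⌋ ∧ not b) (⌊⌋-false (rep (x e) Fin.≟ -q rep (x e)) r≢-r))
                                 (Bool.∧-identityʳ _))

    label-at₁ : ∀ e i → inc (u₁ e) i ≡ e → label z (u₁ e) i ≡ x e
    label-at₁ e i i↦e = cong (label z (u₁ e)) (inc-injective (u₁ e) i (slot₁ e) (trans i↦e (sym (inc-slot₁ e))))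

    label-at₂ : ∀ e j → inc (u₂ e) j ≡ e → label z (u₂ e) j ≡ -q x e
    label-at₂ e j j↦e = begin
      label z (u₂ e) j          ≡⟨ cong (label z (u₂ e)) (inc-injective (u₂ e) j (slot₂ e) (trans j↦e (sym (inc-slot₂ e)))) ⟩
      label z (u₂ e) (slot₂ e)  ≡⟨ +q≡0⇒≡-q (x e) _ (admissible e (slot₁ e) (slot₂ e) (inc-slot₁ e) (inc-slot₂ e)) ⟩
      -q x e                    ∎
      where open ≡-Reasoning

    wHalf-at₁ : ∀ e {v} i → inc v i ≡ e → u₁ e ≡ v → wHalf G k inc col dir v i ≡ label z v i
    wHalf-at₁ e i i↦e refl with rep (x e) Fin.≟ -q rep (x e)
    ... | yes r≡-r = begin
      wHalf G k inc col dir (u₁ e) i  ≡⟨ wHalf-selfInverse col dir (u₁ e) i i↦e (subst (λ b → b ≡ -q b) (sym (colour e)) r≡-r) ⟩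
      lookup col e                    ≡⟨ colour e ⟩
      rep (x e)                       ≡⟨ rep-selfInverse (x e) r≡-r ⟨
      x e                             ≡⟨ label-at₁ e i i↦e ⟨
      label z (u₁ e) i                ∎
      where open ≡-Reasoning
    ... | no r≢-r = begin
      wHalf G k inc col dir (u₁ e) i              ≡⟨ wHalf-signed col dir (u₁ e) i i↦e (subst (λ b → ¬ b ≡ -q b) (sym (colour e)) r≢-r) ⟩
      signed (lookup col e) ⌊ headOf′ dir e Fin.≟ u₁ e ⌋  ≡⟨ cong₂ signed (colour e) (trans (head≟u₁ dir e) (direction-nonSelfInverse e r≢-r)) ⟩
      signed (rep (x e)) ⌊ x e Fin.≟ rep (x e) ⌋  ≡⟨ signed-rep (x e) ⟩
      x e                                         ≡⟨ label-at₁ e i i↦e ⟨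
      label z (u₁ e) i                            ∎
      where open ≡-Reasoning

    wHalf-at₂ : ∀ e {v} j → inc v j ≡ e → u₂ e ≡ v → wHalf G k inc col dir v j ≡ label z v j
    wHalf-at₂ e j j↦e refl with rep (x e) Fin.≟ -q rep (x e)
    ... | yes r≡-r = begin
      wHalf G k inc col dir (u₂ e) j  ≡⟨ wHalf-selfInverse col dir (u₂ e) j j↦e (subst (λ b → b ≡ -q b) (sym (colour e)) r≡-r) ⟩
      lookup col e                    ≡⟨ colour e ⟩
      rep (x e)                       ≡⟨ r≡-r ⟩
      -q rep (x e)                    ≡⟨ cong -q_ (rep-selfInverse (x e) r≡-r) ⟨
      -q x e                          ≡⟨ label-at₂ e j j↦e ⟨
      label z (u₂ e) j                ∎
      where open ≡-Reasoning
    ... | no r≢-r = begin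
      wHalf G k inc col dir (u₂ e) j                    ≡⟨ wHalf-signed col dir (u₂ e) j j↦e (subst (λ b → ¬ b ≡ -q b) (sym (colour e)) r≢-r) ⟩
      signed (lookup col e) ⌊ headOf′ dir e Fin.≟ u₂ e ⌋
        ≡⟨ cong₂ signed (colour e) (trans (head≟u₂ dir e) (cong not (direction-nonSelfInverse e r≢-r))) ⟩
      signed (rep (x e)) (not ⌊ x e Fin.≟ rep (x e) ⌋)  ≡⟨ signed-rep-not (x e) ⟩
      -q x e                                            ≡⟨ label-at₂ e j j↦e ⟨
      label z (u₂ e) j                                  ∎
      where open ≡-Reasoning

    wHalf-factorization : ∀ v i → wHalf G k inc col dir v i ≡ label z v i
    wHalf-factorization v i with inc-incident v i
    ... | inj₁ u₁≡v = wHalf-at₁ (inc v i) i refl u₁≡v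
    ... | inj₂ u₂≡v = wHalf-at₂ (inc v i) i refl u₂≡v

    labelling∘factorization : labelling (factorization z) ≡ z
    labelling∘factorization = Vec-ext z (λ v → Vec-ext (lookup z v) (wHalf-factorization v))

  module OfNonVanishing (z : Labelling) (admissible : Admissible G k inc z) (nonvanishing : NonVanishing z) where

    open OfAdmissible z admissible

    private
      col : Vec (Fin q) m
      col = proj₁ (factorization z)
      dir : Vec Bool m
      dir = proj₂ (factorization z)

    label-∈K : ∀ v i → label z v i ∈ K
    label-∈K v = proj₁ (φ≢0⇒ K (label z v) (nonvanishing v))

    label-injective : ∀ v i j → label z v i ≡ label z v j → i ≡ j
    label-injective v = proj₂ (φ≢0⇒ K (label z v) (nonvanishing v))

    colour∈P : ∀ e → lookup col e ∈ P
    colour∈P e = subst (_∈ P) (sym (colour e)) (rep-∈P (label-∈K (u₁ e) (slot₁ e)))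

    module _ (v : Fin n) (i : Fin k) {b : Fin q} where

      colour≡⇒label± : lookup col (inc v i) ≡ b → label z v i ≡ b ⊎ label z v i ≡ -q b
      colour≡⇒label± refl = Sum.map (trans (sym (wHalf-factorization v i))) (trans (sym (wHalf-factorization v i))) (wHalf-± col dir v i refl)

      label±⇒colour≡ : b ∈ P → label z v i ≡ b ⊎ label z v i ≡ -q b → lookup col (inc v i) ≡ b
      label±⇒colour≡ b∈P = wHalf-±⇒colour col dir v i b∈P (colour∈P (inc v i)) ∘ subst (λ y → y ≡ b ⊎ y ≡ -q b) (sym (wHalf-factorization v i))

      into⇒label≡ : ¬ b ≡ -q b → lookup col (inc v i) ≡ b × headOf′ dir (inc v i) ≡ v → label z v i ≡ b
      into⇒label≡ b≢-b (refl , into) = trans (sym (wHalf-factorization v i)) (into⇒wHalf≡ col dir v i b≢-b into)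

      label≡⇒into : b ∈ P → ¬ b ≡ -q b → label z v i ≡ b → lookup col (inc v i) ≡ b × headOf′ dir (inc v i) ≡ v
      label≡⇒into b∈P b≢-b label≡b with refl ← label±⇒colour≡ b∈P (inj₁ label≡b) =
        refl , wHalf≡⇒into col dir v i b≢-b (trans (wHalf-factorization v i) label≡b)

      outOf⇒label≡- : ¬ b ≡ -q b → lookup col (inc v i) ≡ b × tailOf′ dir (inc v i) ≡ v → label z v i ≡ -q b
      outOf⇒label≡- b≢-b (refl , out) = trans (sym (wHalf-factorization v i)) (outOf⇒wHalf≡- col dir v i b≢-b out)

      label≡-⇒outOf : b ∈ P → ¬ b ≡ -q b → label z v i ≡ -q b → lookup col (inc v i) ≡ b × tailOf′ dir (inc v i) ≡ v
      label≡-⇒outOf b∈P b≢-b label≡-b with refl ← label±⇒colour≡ b∈P (inj₂ label≡-b) =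
        refl , wHalf≡-⇒outOf col dir v i b≢-b (trans (wHalf-factorization v i) label≡-b)

    -- label z v is a bijection onto K, as ∣ K ∣ ≡ k
    slotOf : ∀ v {y} → y ∈ K → ∃ λ i → label z v i ≡ y
    slotOf v = injective-into-full K ∣K∣≡k (label z v) (label-∈K v) (label-injective v)

    factorization-isOriented : IsOrientedFactorization (factorization z)
    factorization-isOriented = record
      { colour∈P = colour∈P ; degree = degree ; in-out-degree = in-out-degree ; undirected = selfInverse-undirected }
      where
      degree : ∀ b → b ∈ P → ∀ v → (b ≡ -q b → degA G k inc col v b ≡ 1) × (¬ b ≡ -q b → degA G k inc col v b ≡ 2)
      degree b b∈P v = (λ b≡-b → Enumerates-length (Enumerates-filter-allFin _) (one-slot b≡-b)) ,
                       (λ b≢-b → Enumerates-length (Enumerates-filter-allFin _) (two-slots b≢-b))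
        where
        i₀ : ∃ λ i → label z v i ≡ b
        i₀ = slotOf v (P⊆K b∈P)
        j₀ : ∃ λ i → label z v i ≡ -q b
        j₀ = slotOf v (-P⊆K b∈P)
        one-slot : b ≡ -q b → Enumerates (λ i → lookup col (inc v i) ≡ b) [ proj₁ i₀ ]
        one-slot b≡-b = Enumerates-[ proj₁ i₀ ] (label±⇒colour≡ v (proj₁ i₀) b∈P (inj₁ (proj₂ i₀)))
          λ j colour≡b → label-injective v j (proj₁ i₀) (case colour≡⇒label± v j colour≡b of λ where
            (inj₁ label≡b) → trans label≡b (sym (proj₂ i₀))
            (inj₂ label≡-b) → trans label≡-b (trans (sym b≡-b) (sym (proj₂ i₀))))
        two-slots : ¬ b ≡ -q b → Enumerates (λ i → lookup col (inc v i) ≡ b) (proj₁ i₀ ∷ proj₁ j₀ ∷ [])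
        two-slots b≢-b = Enumerates-pair (proj₁ i₀) (proj₁ j₀)
          (λ i₀≡j₀ → b≢-b (trans (sym (proj₂ i₀)) (trans (cong (label z v) i₀≡j₀) (proj₂ j₀))))
          (label±⇒colour≡ v (proj₁ i₀) b∈P (inj₁ (proj₂ i₀)))
          (label±⇒colour≡ v (proj₁ j₀) b∈P (inj₂ (proj₂ j₀)))
          λ j colour≡b → Sum.map (λ label≡b → label-injective v j (proj₁ i₀) (trans label≡b (sym (proj₂ i₀))))
                                 (λ label≡-b → label-injective v j (proj₁ j₀) (trans label≡-b (sym (proj₂ j₀))))
                                 (colour≡⇒label± v j colour≡b)
      in-out-degree : ∀ b → b ∈ P → ¬ b ≡ -q b → ∀ v → inDegA G k inc col dir v b ≡ 1 × outDegA G k inc col dir v b ≡ 1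
      in-out-degree b b∈P b≢-b v =
        Enumerates-length (Enumerates-filter-allFin _) (Enumerates-[ proj₁ i₀ ] (label≡⇒into v (proj₁ i₀) b∈P b≢-b (proj₂ i₀))
          λ j into → label-injective v j (proj₁ i₀) (trans (into⇒label≡ v j b≢-b into) (sym (proj₂ i₀)))) ,
        Enumerates-length (Enumerates-filter-allFin _) (Enumerates-[ proj₁ j₀ ] (label≡-⇒outOf v (proj₁ j₀) b∈P b≢-b (proj₂ j₀))
          λ j out → label-injective v j (proj₁ j₀) (trans (outOf⇒label≡- v j b≢-b out) (sym (proj₂ j₀))))
        where
        i₀ : ∃ λ i → label z v i ≡ b
        i₀ = slotOf v (P⊆K b∈P)
        j₀ : ∃ λ i → label z v i ≡ -q b
        j₀ = slotOf v (-P⊆K b∈P)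
      selfInverse-undirected : ∀ e → lookup col e ≡ -q lookup col e → lookup dir e ≡ false
      selfInverse-undirected e c≡-c = trans (direction e)
        (trans (cong (λ b → ⌊ label₁ z e Fin.≟ rep (label₁ z e) ⌋ ∧ not b)
                     (⌊⌋-true (rep (label₁ z e) Fin.≟ -q rep (label₁ z e)) (subst (λ b → b ≡ -q b) (colour e) c≡-c)))
               (Bool.∧-zeroʳ _))

    sgnF-factorization : sgnF G k inc (factorization z) ≡ weight G k inc K z
    sgnF-factorization = cong prodℤ (map-cong (λ v →
      trans (sgn-cong (wHalf-factorization v)) (sym (φ-inside K (label z v) (label-∈K v)))) (allFin n))

  componentEdges : Vec (Fin q) m → Fin q → Fin n → List (Fin m)
  componentEdges col a v = filter (Component.inComponent? G k inc ho col a v) (allFin m)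

  OddComponent : Vec (Fin q) m → Set
  OddComponent col = ∃ λ a → a ∈ P × ¬ a ≡ -q a × ∃ λ v → ¬ 2 ∣ length (componentEdges col a v)

  oddComponent? : ∀ col → Dec (OddComponent col)
  oddComponent? col = any? λ a → (a ∈? P) ×-dec ¬? (a Fin.≟ -q a) ×-dec any? (λ v → ¬? (2 ∣? length (componentEdges col a v)))

  isBipartite⇔noOddComponent : ∀ F → IsOrientedBipartiteFactorization G k inc P F ⇔ (IsOrientedFactorization F × ¬ OddComponent (proj₁ F))
  isBipartite⇔noOddComponent (col , dir) = mk⇔
    (λ (col∈P , degree , bipartite , in-out-degree , undirected) →
       record { colour∈P = col∈P ; degree = degree ; in-out-degree = in-out-degree ; undirected = undirected } ,
       λ (a , a∈P , a≢-a , v , odd) → odd (bipartite a a∈P a≢-a v (componentEdges col a v) (Enumerates-filter-allFin _)))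
    (λ (fact , noOdd) → let open IsOrientedFactorization fact in
       colour∈P , degree , even noOdd , in-out-degree , undirected)
    where
    even : ¬ OddComponent col → ∀ a → a ∈ P → ¬ a ≡ -q a → EvenComponents G k inc col a
    even noOdd a a∈P a≢-a v edges enumEdges with 2 ∣? length (componentEdges col a v)
    ... | yes 2∣ = subst (2 ∣_) (Enumerates-length (Enumerates-filter-allFin _) enumEdges) 2∣
    ... | no odd = ⊥-elim (noOdd (a , a∈P , a≢-a , v , odd))

  signed-not : ∀ a into → signed a (not into) ≡ -q signed a into
  signed-not a true = refl
  signed-not a false = sym (-q-involutive a)

  module Reversal (col : Vec (Fin q) m) (a : Fin q) (v₀ : Fin n) where

    open Component G k inc ho col a v₀

    reversed : Vec Bool m → Vec Bool m
    reversed dir = Vec.tabulate (λ e → lookup dir e xor ⌊ inComponent? e ⌋)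

    reversed-involutive : ∀ dir → reversed (reversed dir) ≡ dir
    reversed-involutive dir = Vec-ext dir λ e → begin
      lookup (reversed dir) e xor ⌊ inComponent? e ⌋            ≡⟨ cong (_xor ⌊ inComponent? e ⌋) (lookup∘tabulate _ e) ⟩
      (lookup dir e xor ⌊ inComponent? e ⌋) xor ⌊ inComponent? e ⌋ ≡⟨ Bool.xor-assoc (lookup dir e) _ _ ⟩
      lookup dir e xor (⌊ inComponent? e ⌋ xor ⌊ inComponent? e ⌋) ≡⟨ cong (lookup dir e xor_) (Bool.xor-same ⌊ inComponent? e ⌋) ⟩
      lookup dir e xor false                                    ≡⟨ Bool.xor-identityʳ _ ⟩
      lookup dir e                                              ∎
      where open ≡-Reasoning

    module _ (dir : Vec Bool m) where

      reversed-outside : ∀ e → ¬ InComponent e → lookup (reversed dir) e ≡ lookup dir e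
      reversed-outside e ∉C = trans (lookup∘tabulate _ e) (trans (cong (lookup dir e xor_) (⌊⌋-false (inComponent? e) ∉C)) (Bool.xor-identityʳ _))

      reversed-inside : ∀ e → InComponent e → lookup (reversed dir) e ≡ not (lookup dir e)
      reversed-inside e ∈C = trans (lookup∘tabulate _ e)
        (trans (cong (lookup dir e xor_) (⌊⌋-true (inComponent? e) ∈C)) (trans (Bool.xor-comm (lookup dir e) true) (Bool.true-xor _)))

      ends-outside : ∀ e → ¬ InComponent e → headOf′ (reversed dir) e ≡ headOf′ dir e × tailOf′ (reversed dir) e ≡ tailOf′ dir e
      ends-outside e ∉C rewrite reversed-outside e ∉C = refl , refl

      ends-inside : ∀ e → InComponent e → headOf′ (reversed dir) e ≡ tailOf′ dir e × tailOf′ (reversed dir) e ≡ headOf′ dir e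
      ends-inside e ∈C rewrite reversed-inside e ∈C with lookup dir e
      ... | true = refl , refl
      ... | false = refl , refl

      wHalf-outside : ∀ v i → ¬ InComponent (inc v i) → wHalf G k inc col (reversed dir) v i ≡ wHalf G k inc col dir v i
      wHalf-outside v i ∉C = cases (lookup col (inc v i) Fin.≟ -q lookup col (inc v i))
        where
        cases : Dec (lookup col (inc v i) ≡ -q lookup col (inc v i)) → _
        cases (yes c≡-c) = trans (wHalf-selfInverse col (reversed dir) v i refl c≡-c) (sym (wHalf-selfInverse col dir v i refl c≡-c))
        cases (no c≢-c) = begin
          wHalf G k inc col (reversed dir) v i                                ≡⟨ wHalf-signed col (reversed dir) v i refl c≢-c ⟩
          signed (lookup col (inc v i)) ⌊ headOf′ (reversed dir) (inc v i) Fin.≟ v ⌋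
            ≡⟨ cong (λ h → signed _ ⌊ h Fin.≟ v ⌋) (proj₁ (ends-outside (inc v i) ∉C)) ⟩
          signed (lookup col (inc v i)) ⌊ headOf′ dir (inc v i) Fin.≟ v ⌋     ≡⟨ wHalf-signed col dir v i refl c≢-c ⟨
          wHalf G k inc col dir v i                                           ∎
          where open ≡-Reasoning

      wHalf-inside : ¬ a ≡ -q a → ∀ v i → InComponent (inc v i) → wHalf G k inc col (reversed dir) v i ≡ -q wHalf G k inc col dir v i
      wHalf-inside a≢-a v i ∈C = begin
        wHalf G k inc col (reversed dir) v i                          ≡⟨ wHalf-signed col (reversed dir) v i refl c≢-c ⟩
        signed c ⌊ headOf′ (reversed dir) (inc v i) Fin.≟ v ⌋
          ≡⟨ cong (λ h → signed c ⌊ h Fin.≟ v ⌋) (proj₁ (ends-inside (inc v i) ∈C)) ⟩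
        signed c ⌊ tailOf′ dir (inc v i) Fin.≟ v ⌋                    ≡⟨ cong (signed c) tail≟ ⟩
        signed c (not ⌊ headOf′ dir (inc v i) Fin.≟ v ⌋)              ≡⟨ signed-not c _ ⟩
        -q signed c ⌊ headOf′ dir (inc v i) Fin.≟ v ⌋                 ≡⟨ cong -q_ (wHalf-signed col dir v i refl c≢-c) ⟨
        -q wHalf G k inc col dir v i                                  ∎
        where
        open ≡-Reasoning
        c : Fin q
        c = lookup col (inc v i)
        c≢-c : ¬ c ≡ -q c
        c≢-c c≡-c = a≢-a (subst (λ b → b ≡ -q b) (proj₁ ∈C) c≡-c)
        tail≟ : ⌊ tailOf′ dir (inc v i) Fin.≟ v ⌋ ≡ not ⌊ headOf′ dir (inc v i) Fin.≟ v ⌋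
        tail≟ with headOf′ dir (inc v i) Fin.≟ v
        ... | yes into = ⌊⌋-false (tailOf′ dir (inc v i) Fin.≟ v) (λ out → tail⇒¬head dir (inc v i) out into)
        ... | no out = ⌊⌋-true (tailOf′ dir (inc v i) Fin.≟ v) (¬head⇒tail dir (inc-incident v i) out)

    module _ (dir : Vec Bool m) (fact : IsOrientedFactorization (col , dir)) (a∈P : a ∈ P) (a≢-a : ¬ a ≡ -q a) where

      open IsOrientedFactorization fact using (degree; in-out-degree)

      module _ (v : Fin n) (b : Fin q) where

        private
          into? : ∀ d i → Dec (lookup col (inc v i) ≡ b × headOf′ d (inc v i) ≡ v)
          into? d i = (lookup col (inc v i) Fin.≟ b) ×-dec (headOf′ d (inc v i) Fin.≟ v)
          outOf? : ∀ d i → Dec (lookup col (inc v i) ≡ b × tailOf′ d (inc v i) ≡ v)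
          outOf? d i = (lookup col (inc v i) Fin.≟ b) ×-dec (tailOf′ d (inc v i) Fin.≟ v)

        degrees-kept : (∀ i → lookup col (inc v i) ≡ b → ¬ InComponent (inc v i)) →
                       inDegA G k inc col (reversed dir) v b ≡ inDegA G k inc col dir v b ×
                       outDegA G k inc col (reversed dir) v b ≡ outDegA G k inc col dir v b
        degrees-kept outside =
          Enumerates-length (Enumerates-filter-allFin (into? (reversed dir))) (Enumerates-resp
            (λ i (c≡b , into) → c≡b , trans (proj₁ (ends-outside dir (inc v i) (outside i c≡b))) into)
            (λ i (c≡b , into) → c≡b , trans (sym (proj₁ (ends-outside dir (inc v i) (outside i c≡b)))) into)
            (Enumerates-filter-allFin (into? dir))) ,
          Enumerates-length (Enumerates-filter-allFin (outOf? (reversed dir))) (Enumerates-resp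
            (λ i (c≡b , out) → c≡b , trans (proj₂ (ends-outside dir (inc v i) (outside i c≡b))) out)
            (λ i (c≡b , out) → c≡b , trans (sym (proj₂ (ends-outside dir (inc v i) (outside i c≡b)))) out)
            (Enumerates-filter-allFin (outOf? dir)))

        degrees-swapped : (∀ i → lookup col (inc v i) ≡ b → InComponent (inc v i)) →
                          inDegA G k inc col (reversed dir) v b ≡ outDegA G k inc col dir v b ×
                          outDegA G k inc col (reversed dir) v b ≡ inDegA G k inc col dir v b
        degrees-swapped inside =
          Enumerates-length (Enumerates-filter-allFin (into? (reversed dir))) (Enumerates-resp
            (λ i (c≡b , out) → c≡b , trans (proj₁ (ends-inside dir (inc v i) (inside i c≡b))) out)
            (λ i (c≡b , into) → c≡b , trans (sym (proj₁ (ends-inside dir (inc v i) (inside i c≡b)))) into)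
            (Enumerates-filter-allFin (outOf? dir))) ,
          Enumerates-length (Enumerates-filter-allFin (outOf? (reversed dir))) (Enumerates-resp
            (λ i (c≡b , into) → c≡b , trans (proj₂ (ends-inside dir (inc v i) (inside i c≡b))) into)
            (λ i (c≡b , out) → c≡b , trans (sym (proj₂ (ends-inside dir (inc v i) (inside i c≡b)))) out)
            (Enumerates-filter-allFin (into? dir)))

      in-out-degree-kept : ∀ b → b ∈ P → ¬ b ≡ -q b → ∀ v → (∀ i → lookup col (inc v i) ≡ b → ¬ InComponent (inc v i)) →
                           inDegA G k inc col (reversed dir) v b ≡ 1 × outDegA G k inc col (reversed dir) v b ≡ 1
      in-out-degree-kept b b∈P b≢-b v outside =
        let in≡ , out≡ = degrees-kept v b outside
            in≡1 , out≡1 = in-out-degree b b∈P b≢-b v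
        in trans in≡ in≡1 , trans out≡ out≡1

      reversed-isOriented : IsOrientedFactorization (col , reversed dir)
      reversed-isOriented = record
        { colour∈P = IsOrientedFactorization.colour∈P fact ; degree = degree ; in-out-degree = in-out-degree′ ; undirected = undirected′ }
        where
        in-out-degree′ : ∀ b → b ∈ P → ¬ b ≡ -q b → ∀ v →
                         inDegA G k inc col (reversed dir) v b ≡ 1 × outDegA G k inc col (reversed dir) v b ≡ 1
        in-out-degree′ b b∈P b≢-b v with b Fin.≟ a | reach? v
        ... | yes refl | yes reached =
          let in≡ , out≡ = degrees-swapped v b (λ i c≡a → inComponent⁺ v i c≡a reached)
              in≡1 , out≡1 = in-out-degree b b∈P b≢-b v
          in trans in≡ out≡1 , trans out≡ in≡1
        ... | yes refl | no unreached = in-out-degree-kept b b∈P b≢-b v (λ i _ → unreached ∘ inComponent⁻ v i)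
        ... | no b≢a | _ = in-out-degree-kept b b∈P b≢-b v (λ i c≡b (c≡a , _) → b≢a (trans (sym c≡b) c≡a))
        undirected′ : ∀ e → lookup col e ≡ -q lookup col e → lookup (reversed dir) e ≡ false
        undirected′ e c≡-c = trans (reversed-outside dir e (λ (c≡a , _) → a≢-a (subst (λ b → b ≡ -q b) c≡a c≡-c)))
                                   (IsOrientedFactorization.undirected fact e c≡-c)

      -- At a vertex of the component the two half-edges of colour a carry the labels a and -a, which the reversal swaps.
      sgn-reached : ∀ v → Reached v → sgn (wHalf G k inc col (reversed dir) v) ≡ - sgn (wHalf G k inc col dir v)
      sgn-reached v reached
        with i₀ , j₀ , i₀≢j₀ , c₀≡a , c₁≡a , only ← Enumerates-length≡2⇒pair (Enumerates-filter-allFin (λ i → lookup col (inc v i) Fin.≟ a))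
                                                                            (proj₂ (degree a a∈P v) a≢-a) =
        sgn-transposed (i₀≢j₀ , β′i₀≡βj₀ , β′j₀≡βi₀ , kept)
        where
        β β′ : Fin k → Fin q
        β = wHalf G k inc col dir v
        β′ = wHalf G k inc col (reversed dir) v
        β± : ∀ {i} → lookup col (inc v i) ≡ a → β i ≡ a ⊎ β i ≡ -q a
        β± {i} c≡a = subst (λ b → β i ≡ b ⊎ β i ≡ -q b) c≡a (wHalf-± col dir v i refl)
        βj₀≡-βi₀ : β j₀ ≡ -q β i₀
        βj₀≡-βi₀ = ≡±⇒≡-q (β± c₀≡a) (β± c₁≡a) (i₀≢j₀ ∘ OfFactorization.labelling-injective col dir fact v i₀ j₀)
        β′i₀≡βj₀ : β′ i₀ ≡ β j₀
        β′i₀≡βj₀ = trans (wHalf-inside dir a≢-a v i₀ (inComponent⁺ v i₀ c₀≡a reached)) (sym βj₀≡-βi₀)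
        β′j₀≡βi₀ : β′ j₀ ≡ β i₀
        β′j₀≡βi₀ = trans (wHalf-inside dir a≢-a v j₀ (inComponent⁺ v j₀ c₁≡a reached))
                         (trans (cong -q_ βj₀≡-βi₀) (-q-involutive (β i₀)))
        kept : ∀ l → l ≢ i₀ → l ≢ j₀ → β′ l ≡ β l
        kept l l≢i₀ l≢j₀ = wHalf-outside dir v l (λ (c≡a , _) → [ l≢i₀ , l≢j₀ ]′ (only l c≡a))

      sgn-unreached : ∀ v → ¬ Reached v → sgn (wHalf G k inc col (reversed dir) v) ≡ sgn (wHalf G k inc col dir v)
      sgn-unreached v unreached = sgn-cong (λ i → wHalf-outside dir v i (unreached ∘ inComponent⁻ v i))

      sgnF-reversed : ¬ 2 ∣ length (componentEdges col a v₀) → sgnF G k inc (col , reversed dir) ≡ - sgnF G k inc (col , dir)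
      sgnF-reversed odd = begin
        sgnF G k inc (col , reversed dir)
          ≡⟨ prodℤ-map-negate-on reach? (λ v → sgn (wHalf G k inc col dir v)) (λ v → sgn (wHalf G k inc col (reversed dir) v))
                                 (allFin n) sgn-reached sgn-unreached ⟩
        -1ℤ ^ length (filter reach? (allFin n)) * sgnF G k inc (col , dir)
          ≡⟨ cong (λ c → -1ℤ ^ c * sgnF G k inc (col , dir)) (handshake (λ v → proj₂ (degree a a∈P v) a≢-a)) ⟩
        -1ℤ ^ length (componentEdges col a v₀) * sgnF G k inc (col , dir)
          ≡⟨ cong (_* sgnF G k inc (col , dir)) (-1ℤ^odd _ odd) ⟩
        -1ℤ * sgnF G k inc (col , dir)
          ≡⟨ ℤ.-1*i≡-i _ ⟩
        - sgnF G k inc (col , dir) ∎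
        where open ≡-Reasoning

  reverseOdd : (col : Vec (Fin q) m) → Dec (OddComponent col) → Vec Bool m → Vec Bool m
  reverseOdd col (yes (a , _ , _ , v , _)) = Reversal.reversed col a v
  reverseOdd col (no _) = id

  involution : Oriented → Oriented
  involution (col , dir) = col , reverseOdd col (oddComponent? col) dir

  involution-involutive : ∀ F → involution (involution F) ≡ F
  involution-involutive (col , dir) = cong (col ,_) (reverseOdd-involutive (oddComponent? col))
    where
    reverseOdd-involutive : ∀ odd? → reverseOdd col odd? (reverseOdd col odd? dir) ≡ dir
    reverseOdd-involutive (yes (a , _ , _ , v , _)) = Reversal.reversed-involutive col a v dir
    reverseOdd-involutive (no _) = refl

  involution-isOriented×sgnF : ∀ F → IsOrientedFactorization F → OddComponent (proj₁ F) →
                               IsOrientedFactorization (involution F) × sgnF G k inc (involution F) ≡ - sgnF G k inc F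
  involution-isOriented×sgnF (col , dir) fact odd = reversing (oddComponent? col)
    where
    reversing : (odd? : Dec (OddComponent col)) →
                IsOrientedFactorization (col , reverseOdd col odd? dir) × sgnF G k inc (col , reverseOdd col odd? dir) ≡ - sgnF G k inc (col , dir)
    reversing (yes (a , a∈P , a≢-a , v , oddSize)) =
      Reversal.reversed-isOriented col a v dir fact a∈P a≢-a , Reversal.sgnF-reversed col a v dir fact a∈P a≢-a oddSize
    reversing (no noOdd) = ⊥-elim (noOdd odd)

  nonVanishing? : ∀ z → Dec (NonVanishing z)
  nonVanishing? z = all? (λ v → ¬? (φ K (label z v) ℤ.≟ 0ℤ))

  weight-vanishing : ∀ z → ¬ NonVanishing z → weight G k inc K z ≡ 0ℤ
  weight-vanishing z vanishing with v , φ≢0-fails ← ¬∀⟶∃¬ n _ (λ v → ¬? (φ K (label z v) ℤ.≟ 0ℤ)) vanishing =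
    prodℤ-map-zero (λ v → φ K (label z v)) (allFin n) (∈-allFin v) (decidable-stable (φ K (label z v) ℤ.≟ 0ℤ) φ≢0-fails)

  orientedFactorizations : List Labelling → List Oriented
  orientedFactorizations zs = map factorization (filter nonVanishing? zs)

  Enumerates-orientedFactorizations : ∀ {zs} → Enumerates (Admissible G k inc) zs →
                                      Enumerates IsOrientedFactorization (orientedFactorizations zs)
  Enumerates-orientedFactorizations enumZ = Enumerates-map factorization labelling
    (λ z (admissible , nonvanishing) → OfNonVanishing.factorization-isOriented z admissible nonvanishing)
    (λ (col , dir) fact → OfFactorization.labelling-admissible col dir fact , OfFactorization.labelling-nonvanishing col dir fact)
    (λ z (admissible , _) → OfAdmissible.labelling∘factorization z admissible)
    (λ (col , dir) fact → OfFactorization.factorization∘labelling col dir fact)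
    (Enumerates-filter⁺ nonVanishing? enumZ)

  sum-weight≡sum-sgnF : ∀ {zs} → Enumerates (Admissible G k inc) zs →
    sumℤ (map (weight G k inc K) zs) ≡ sumℤ (map (sgnF G k inc) (orientedFactorizations zs))
  sum-weight≡sum-sgnF {zs} (zs! , zs≗Admissible) = begin
    sumℤ (map (weight G k inc K) zs)                       ≡⟨ sumℤ-map-filter-vanishing nonVanishing? _ zs weight-vanishing ⟩
    sumℤ (map (weight G k inc K) (filter nonVanishing? zs)) ≡⟨ sumℤ-map-cong _ _ (λ z z∈ → sym (sgnF-factorization z z∈)) ⟩
    sumℤ (map (sgnF G k inc ∘ factorization) (filter nonVanishing? zs)) ≡⟨ cong sumℤ (map-∘ (filter nonVanishing? zs)) ⟩
    sumℤ (map (sgnF G k inc) (orientedFactorizations zs))  ∎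
    where
    open ≡-Reasoning
    sgnF-factorization : ∀ z → z ∈ₗ filter nonVanishing? zs → sgnF G k inc (factorization z) ≡ weight G k inc K z
    sgnF-factorization z z∈ with z∈zs , nonvanishing ← ∈-filter⁻ nonVanishing? {xs = zs} z∈ =
      OfNonVanishing.sgnF-factorization z (proj₁ (zs≗Admissible z) z∈zs) nonvanishing

  -- The involution cancels the oriented factorizations with an odd component in pairs.
  sum-sgnF-oriented≡sum-sgnF-bipartite : ∀ {Fs Bs} → Enumerates IsOrientedFactorization Fs →
    Enumerates (IsOrientedBipartiteFactorization G k inc P) Bs → sumℤ (map (sgnF G k inc) Fs) ≡ sumℤ (map (sgnF G k inc) Bs)
  sum-sgnF-oriented≡sum-sgnF-bipartite {Fs} {Bs} enumF enumB = begin
    sumℤ (map sgnF′ Fs)                                         ≡⟨ sumℤ-map-filter odd? sgnF′ Fs ⟩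
    sumℤ (map sgnF′ (filter odd? Fs)) + sumℤ (map sgnF′ (filter (¬? ∘ odd?) Fs))
      ≡⟨ cong (_+ sumℤ (map sgnF′ (filter (¬? ∘ odd?) Fs))) (sumℤ-involution≡0 involution sgnF′ (Enumerates-filter⁺ odd? enumF)
                        (λ F (fact , odd) → proj₁ (involution-isOriented×sgnF F fact odd) , odd)
                        (λ F _ → involution-involutive F)
                        (λ F (fact , odd) → proj₂ (involution-isOriented×sgnF F fact odd))) ⟩
    0ℤ + sumℤ (map sgnF′ (filter (¬? ∘ odd?) Fs))             ≡⟨ ℤ.+-identityˡ _ ⟩
    sumℤ (map sgnF′ (filter (¬? ∘ odd?) Fs))                    ≡⟨ sumℤ-map-Enumerates sgnF′ enumEven enumB ⟩
    sumℤ (map sgnF′ Bs)                                         ∎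
    where
    open ≡-Reasoning
    sgnF′ : Oriented → ℤ
    sgnF′ = sgnF G k inc
    odd? : ∀ F → Dec (OddComponent (proj₁ F))
    odd? F = oddComponent? (proj₁ F)
    enumEven : Enumerates (IsOrientedBipartiteFactorization G k inc P) (filter (¬? ∘ odd?) Fs)
    enumEven = Enumerates-resp (λ F → Equivalence.from (isBipartite⇔noOddComponent F)) (λ F → Equivalence.to (isBipartite⇔noOddComponent F))
                               (Enumerates-filter⁺ (¬? ∘ odd?) enumF)

lemma4p3 : ∀ {n m : ℕ} (G : Graph n m) (k q : ℕ) (inc : Fin n → Fin k → Fin m) →
  HalfEdgeOrder G k inc → k ≤ q →
  (K P : Subset q) → ∣ K ∣ ≡ k →
  (∀ x → x ∈ K → -q x ∈ K) → (∀ y → y ∈ K → y ∈- K) →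
  (∀ y → y ∈ K → (y ∈ P ⊎ y ∈- P)) → (∀ y → (y ∈ P ⊎ y ∈- P) → y ∈ K) →
  (∀ y → y ∈ P → y ∈- P → y ≡ -q y) →
  ∃ λ (ε : ℤ) → (ε ≡ 1ℤ ⊎ ε ≡ -1ℤ) ×
    (∀ (LF : List (Vec (Fin q) m × Vec Bool m)) →
       Enumerates (IsOrientedBipartiteFactorization G k inc P) LF →
     ∀ (LZ : List (Vec (Vec (Fin q) k) n)) →
       Enumerates (Admissible G k inc) LZ →
     sumℤ (map (sgnF G k inc) LF) ≡ ε * sumℤ (map (weight G k inc K) LZ))
lemma4p3 G k q inc ho _ K P ∣K∣≡k -K⊆K _ K⊆P∪-P P∪-P⊆K P∩-P-selfInverse = 1ℤ , inj₁ refl , λ LF enumF LZ enumZ → begin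
  sumℤ (map (sgnF G k inc) LF)                            ≡⟨ sum-sgnF-oriented≡sum-sgnF-bipartite (Enumerates-orientedFactorizations enumZ) enumF ⟨
  sumℤ (map (sgnF G k inc) (orientedFactorizations LZ))   ≡⟨ sum-weight≡sum-sgnF enumZ ⟨
  sumℤ (map (weight G k inc K) LZ)                        ≡⟨ ℤ.*-identityˡ _ ⟨
  1ℤ * sumℤ (map (weight G k inc K) LZ)                   ∎
  where
  open ≡-Reasoning
  open Factorizations G k inc ho K P ∣K∣≡k -K⊆K K⊆P∪-P P∪-P⊆K P∩-P-selfInverse
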